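{- Let $n\ge5$ and let $A$ be a 4-colouring of $H_n$ with $A(a)=1$, $|p(A)|=d(A)=2$, such that both type-1 edges of $A(1,2)$ are $A$-nonsingular. (c) If $e_1,e_2$ are edges of type 1 with a common vertex belonging to $N_b$ and $e_1$ is a Kempe chain of $A(3,4)$, then there exists a 4-colouring $B$ of $H_n$ with $B(a)=1$, equal to $A$, such that $|p(B)|=d(B)=2$, both type-1 edges of $B(1,2)$ are $B$-nonsingular, and $e_2$ is a Kempe chain of $B(3,4)$. (d) If $e,f$ are consecutive parallel edges of type 1 and $e$ is a Kempe chain of $A(3,4)$, then there exists a 4-colouring $B$ of $H_n$ with $B(a)=1$ such that $A$ and $B$ are equivalent up to 3 Kempe changes, $|p(B)|=d(B)=2$, both type-1 edges of $B(1,2)$ are $B$-nonsingular, and $f$ is a Kempe chain of $B(3,4)$.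
   Context: Fix $n\ge5$. $G_n$ is a simple plane triangulation having two non-adjacent vertices $a,b$ of degree $n$ (the poles) and $2n$ vertices of degree $5$; $N_a,N_b$ are the cycles induced by the neighbours of $a$ and $b$; $H_n=G_n-b$. An edge is of type 1 if one end lies on $N_a$ and the other on $N_b$. The $2n$ type-1 edges can be listed in cyclic order $g_1,\dots,g_{2n}$ around the annulus between $N_a$ and $N_b$ so that $g_i$ and $g_{i+1}$ (indices mod $2n$) share a vertex; two type-1 edges are consecutive parallel edges if they are $g_i$ and $g_{i+2}$ for some $i$. A type-1 edge $xy$ lies on exactly two facial triangles $xyz$ and $xyw$ of $G_n$; it is $A$-singular if $A(z)=A(w)$ and $A$-nonsingular otherwise. 4-colourings of $H_n$ are maps $V(H_n)\to\{1,2,3,4\}$ giving adjacent vertices different colours, normalized so that $A(a)=1$. $A(i,j)$ is the subgraph induced by vertices coloured $i$ or $j$; its components are Kempe chains; a Kempe change swaps $i,j$ on one chain, and it is proper if that chain is not the whole of $A(i,j)$. Colourings $A,B$ are equal if $A=P\circ B$ for a permutation $P$ of the colours. $d(A)$ is the number of type-1 edges in $A(1,2)$; $p(A)$ is the set of vertices of $N_b$ coloured 1. "$A$ and $B$ are equivalent up to $m$ Kempe changes" means $B$ can be obtained from $A$ by a sequence of Kempe changes at most $m$ of which are proper. -}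

module Defs where

-- Concrete model of G_n (the antiprism on the cycles N_a, N_b capped by the
-- poles a, b), of H_n = G_n - b, and of the colouring notions of the paper.
-- Vertices of H_n:  pa = a,  xa i = i-th vertex of N_a,  yb i = i-th vertex of N_b
-- (indices in Fin n, read cyclically).  Edges of G_n:
--   a x_i,  b y_i,  x_i x_{i+1},  y_i y_{i+1},  x_i y_i,  x_i y_{i+1}.
-- Type-1 edges: g_{2i} = x_i y_i  (te0 i),  g_{2i+1} = x_i y_{i+1}  (te1 i).

open import Data.Nat using (ℕ; zero; suc; _+_)
open import Data.Nat.DivMod using (_%_; m%n<n)
open import Data.Fin using (Fin; toℕ; fromℕ<; _≟_)
open import Data.Fin.Permutation using (Permutation′; _⟨$⟩ʳ_)
open import Data.List using (List; length; filter; map; _++_; allFin)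
open import Data.Product using (Σ; ∃; _×_; _,_; proj₁; proj₂)
open import Data.Sum using (_⊎_; inj₁; inj₂)
open import Data.Bool using (if_then_else_)
open import Relation.Nullary using (¬_; Dec; does; _×-dec_; _⊎-dec_)
open import Relation.Binary.PropositionalEquality using (_≡_; _≢_)

next : ∀ {n} → Fin n → Fin n
next {suc m} i = fromℕ< (m%n<n (suc (toℕ i)) (suc m))

prev : ∀ {n} → Fin n → Fin n
prev {suc m} i = fromℕ< (m%n<n (toℕ i + m) (suc m))

Colour : Set
Colour = Fin 4

c1 c2 c3 c4 : Colour
c1 = Fin.zero
c2 = Fin.suc Fin.zero
c3 = Fin.suc (Fin.suc Fin.zero)
c4 = Fin.suc (Fin.suc (Fin.suc Fin.zero))

data V (n : ℕ) : Set where
  pa : V n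
  xa : Fin n → V n
  yb : Fin n → V n

data Adj {n : ℕ} : V n → V n → Set where
  ax  : ∀ i → Adj pa (xa i)
  xx  : ∀ i → Adj (xa i) (xa (next i))
  yy  : ∀ i → Adj (yb i) (yb (next i))
  xy0 : ∀ i → Adj (xa i) (yb i)
  xy1 : ∀ i → Adj (xa i) (yb (next i))
  sy  : ∀ {u v} → Adj u v → Adj v u

Map : ℕ → Set
Map n = V n → Colour

IsColouring : ∀ {n} → Map n → Set
IsColouring {n} A = ∀ (u v : V n) → Adj u v → A u ≢ A v

NormColouring : ∀ {n} → Map n → Set
NormColouring A = IsColouring A × A pa ≡ c1

InC : Colour → Colour → Colour → Set
InC i j c = c ≡ i ⊎ c ≡ j

data Path {n : ℕ} (A : Map n) (i j : Colour) : V n → V n → Set where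
  here : ∀ {u} → Path A i j u u
  step : ∀ {u v w} → InC i j (A u) → Adj u v → InC i j (A v) →
         Path A i j v w → Path A i j u w

swap : Colour → Colour → Colour → Colour
swap i j c = if does (c ≟ i) then j else (if does (c ≟ j) then i else c)

Kempe : ∀ {n} → Map n → Map n → Colour → Colour → V n → Set
Kempe {n} A B i j v =
  i ≢ j × InC i j (A v) ×
  (∀ (w : V n) → Path A i j v w → B w ≡ swap i j (A w)) ×
  (∀ (w : V n) → ¬ Path A i j v w → B w ≡ A w)

ProperChain : ∀ {n} → Map n → Colour → Colour → V n → Set
ProperChain {n} A i j v = Σ (V n) λ w → InC i j (A w) × ¬ Path A i j v w

-- EquivUpTo m A B : B obtained from A by a sequence of Kempe changes,
-- at most m of which are proper
data EquivUpTo {n : ℕ} : ℕ → Map n → Map n → Set where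
  done : ∀ {m A} → EquivUpTo m A A
  impr : ∀ {m A C B} i j v → Kempe A C i j v → ¬ ProperChain A i j v →
         EquivUpTo m C B → EquivUpTo m A B
  prop : ∀ {m A C B} i j v → Kempe A C i j v → ProperChain A i j v →
         EquivUpTo m C B → EquivUpTo (suc m) A B

-- A and B are equal: A = P ∘ B for a permutation P of the colours
EqualCol : ∀ {n} → Map n → Map n → Set
EqualCol {n} A B = Σ (Permutation′ 4) λ P → ∀ (v : V n) → A v ≡ P ⟨$⟩ʳ B v

data TE (n : ℕ) : Set where
  te0 : Fin n → TE n
  te1 : Fin n → TE n

allTE : ∀ n → List (TE n)
allTE n = map te0 (allFin n) ++ map te1 (allFin n)

ends : ∀ {n} → TE n → V n × V n
ends (te0 i) = xa i , yb i
ends (te1 i) = xa i , yb (next i)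

Incident : ∀ {n} → V n → TE n → Set
Incident v e = v ≡ proj₁ (ends e) ⊎ v ≡ proj₂ (ends e)

-- third vertices z, w of the two facial triangles of G_n containing e
faces : ∀ {n} → TE n → V n × V n
faces (te0 i) = xa (prev i) , yb (next i)
faces (te1 i) = yb i , xa (next i)

Nonsingular : ∀ {n} → Map n → TE n → Set
Nonsingular A e = A (proj₁ (faces e)) ≢ A (proj₂ (faces e))

EdgeIn12 : ∀ {n} → Map n → TE n → Set
EdgeIn12 A e = InC c1 c2 (A (proj₁ (ends e))) × InC c1 c2 (A (proj₂ (ends e)))

edgeIn12? : ∀ {n} (A : Map n) (e : TE n) → Dec (EdgeIn12 A e)
edgeIn12? A e =
  ((A (proj₁ (ends e)) ≟ c1) ⊎-dec (A (proj₁ (ends e)) ≟ c2)) ×-dec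
  ((A (proj₂ (ends e)) ≟ c1) ⊎-dec (A (proj₂ (ends e)) ≟ c2))

d : ∀ {n} → Map n → ℕ
d {n} A = length (filter (edgeIn12? A) (allTE n))

p# : ∀ {n} → Map n → ℕ
p# {n} A = length (filter (λ i → A (yb i) ≟ c1) (allFin n))

Good : ∀ {n} → Map n → Set
Good {n} A = p# A ≡ 2 × d A ≡ 2 × (∀ (e : TE n) → EdgeIn12 A e → Nonsingular A e)

ChainOf34 : ∀ {n} → Map n → TE n → Set
ChainOf34 {n} A e =
  InC c3 c4 (A (proj₁ (ends e))) × InC c3 c4 (A (proj₂ (ends e))) ×
  (∀ (w : V n) → Path A c3 c4 (proj₁ (ends e)) w →
     w ≡ proj₁ (ends e) ⊎ w ≡ proj₂ (ends e))

shift2 : ∀ {n} → TE n → TE n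
shift2 (te0 i) = te0 (next i)
shift2 (te1 i) = te1 (next i)

-- e, f are consecutive parallel edges: {e,f} = {g_k, g_{k+2}} for some k
ConsecParallel : ∀ {n} → TE n → TE n → Set
ConsecParallel e f = f ≡ shift2 e ⊎ e ≡ shift2 f

-- Reading the annulus between N_a and N_b as a zigzag x_i, y_(i+1), x_(i+1), ... of length 2n,
-- in which vertices one or two apart are adjacent and the even positions are the neighbours
-- of a, place a type-1 edge that is a Kempe chain of A(3,4) at positions 4, 5. The chain, the
-- conditions |p(A)| = d(A) = 2 and the nonsingularity of the two 12-edges then force A to
-- spell the word α β 2 1 α β 2 1 (α β 2)* along the zigzag, with {α, β} = {3, 4} and
-- 2n ≡ 2 (mod 3); conversely every such colouring is good and has its edge at 4, 5 as a
-- 34-chain. In (c) an edge through the y-vertex at 5 other than the chain sits at 5, 6, and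
-- exchanging α and 2 moves the chain there. In (d) four Kempe changes, only the first
-- improper, turn the word into the canonical one read from position 2 or from position -2,
-- that is, around the parallel edge.

module Submission where

open import Defs
open import Data.Nat using (>-nonZero; NonZero; _*_; _+_; _<?_; _<_; _<ᵇ_; _∸_; _≤_; suc; s≤s; zero; z≤n; ℕ)
open import Data.Nat.Properties
open import Data.Nat.DivMod using (%-distribˡ-+; [m+n]%n≡m%n; _%_; _/_; m%n%n≡m%n; m%n<n; m<n⇒m%n≡m; m≡m%n+[m/n]*n)
open import Data.Bool using (T)
open import Data.Fin using (Fin; toℕ) renaming (_≟_ to _≟ᶠ_)
open import Data.Fin.Properties using (all?; toℕ-fromℕ<; toℕ-injective; toℕ<n)
open import Data.Product using (_,_; _×_; proj₁; proj₂; Σ; Σ-syntax; ∃-syntax)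
open import Data.Sum using ([_,_]′; _⊎_; inj₁; inj₂)
open import Data.Empty using (⊥; ⊥-elim)
open import Relation.Nullary using (Dec; _×-dec_; _⊎-dec_; no; yes; ¬?; ¬_)
open import Relation.Binary.PropositionalEquality
open import Relation.Binary.Definitions using (tri<; tri>; tri≈)
open import Data.List using (List; []; _∷_; allFin; filter; length; map)
open import Data.List.Membership.Propositional using (_∈_)
open import Data.List.Membership.Propositional.Properties using (∈-++⁺ʳ; ∈-++⁺ˡ; ∈-allFin; ∈-filter⁺; ∈-filter⁻; ∈-map⁺; ∈-map⁻)
open import Data.List.Relation.Unary.Any using (here; there)
open import Data.List.Relation.Unary.All using (_∷_)
open import Data.List.Relation.Unary.AllPairs using (_∷_)
open import Data.List.Relation.Unary.Unique.Propositional using (Unique)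
open import Data.List.Relation.Unary.Unique.Propositional.Properties using (++⁺; allFin⁺; filter⁺; map⁺)
open import Relation.Unary using (Decidable)
import Data.Fin as Fin
open import Relation.Nullary.Decidable using (_→-dec_; toWitness)
open import Data.Fin.Permutation using (Permutation′; permutation)
import Data.Fin.Permutation as Permutation
open import Function using (_∘_)

<-fromᵇ : ∀ m n → {T (m <ᵇ n)} → m < n
<-fromᵇ m n {h} = <ᵇ⇒< m n h

data Dir : Set where
  fw bw : Dir

opposite : Dir → Dir
opposite fw = bw
opposite bw = fw

module _ {m : ℕ} where
  private
    N = suc m

  move : Dir → Fin N → Fin N
  move fw = next
  move bw = prev

  move^ : Dir → ℕ → Fin N → Fin N
  move^ o zero i = i
  move^ o (suc k) i = move o (move^ o k i)

  [m+n%N]%N≡[m+n]%N : ∀ a b → (a + b % N) % N ≡ (a + b) % N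
  [m+n%N]%N≡[m+n]%N a b = begin
    (a + b % N) % N          ≡⟨ %-distribˡ-+ a (b % N) N ⟩
    (a % N + b % N % N) % N  ≡⟨ cong (λ z → (a % N + z) % N) (m%n%n≡m%n b N) ⟩
    (a % N + b % N) % N      ≡⟨ %-distribˡ-+ a b N ⟨
    (a + b) % N              ∎
    where open ≡-Reasoning

  toℕ+N%N : (i : Fin N) → (toℕ i + N) % N ≡ toℕ i
  toℕ+N%N i = trans ([m+n]%n≡m%n (toℕ i) N) (m<n⇒m%n≡m (toℕ<n i))

  toℕ-move^-fw : ∀ k (i : Fin N) → toℕ (move^ fw k i) ≡ (toℕ i + k) % N
  toℕ-move^-fw zero i = trans (sym (m<n⇒m%n≡m (toℕ<n i))) (cong (_% N) (sym (+-identityʳ (toℕ i))))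
  toℕ-move^-fw (suc k) i = begin
    toℕ (next (move^ fw k i))       ≡⟨ toℕ-fromℕ< _ ⟩
    (1 + toℕ (move^ fw k i)) % N    ≡⟨ cong (λ z → (1 + z) % N) (toℕ-move^-fw k i) ⟩
    (1 + (toℕ i + k) % N) % N       ≡⟨ [m+n%N]%N≡[m+n]%N 1 (toℕ i + k) ⟩
    (1 + (toℕ i + k)) % N           ≡⟨ cong (_% N) (+-suc (toℕ i) k) ⟨
    (toℕ i + suc k) % N             ∎
    where open ≡-Reasoning

  prev-next : (i : Fin N) → prev (next i) ≡ i
  prev-next i = toℕ-injective (begin
    toℕ (prev (next i))           ≡⟨ toℕ-fromℕ< _ ⟩
    (toℕ (next i) + m) % N        ≡⟨ cong (λ z → (z + m) % N) (toℕ-move^-fw 1 i) ⟩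
    ((toℕ i + 1) % N + m) % N     ≡⟨ cong (_% N) (+-comm ((toℕ i + 1) % N) m) ⟩
    (m + (toℕ i + 1) % N) % N     ≡⟨ [m+n%N]%N≡[m+n]%N m (toℕ i + 1) ⟩
    (m + (toℕ i + 1)) % N         ≡⟨ cong (_% N) (trans (+-comm m (toℕ i + 1)) (trans (+-assoc (toℕ i) 1 m) refl)) ⟩
    (toℕ i + N) % N               ≡⟨ toℕ+N%N i ⟩
    toℕ i                         ∎)
    where open ≡-Reasoning

  next-prev : (i : Fin N) → next (prev i) ≡ i
  next-prev i = toℕ-injective (begin
    toℕ (next (prev i))           ≡⟨ toℕ-fromℕ< _ ⟩
    (1 + toℕ (prev i)) % N        ≡⟨ cong (λ z → (1 + z) % N) (toℕ-fromℕ< _) ⟩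
    (1 + (toℕ i + m) % N) % N     ≡⟨ [m+n%N]%N≡[m+n]%N 1 (toℕ i + m) ⟩
    (1 + (toℕ i + m)) % N         ≡⟨ cong (_% N) (+-suc (toℕ i) m) ⟨
    (toℕ i + N) % N               ≡⟨ toℕ+N%N i ⟩
    toℕ i                         ∎)
    where open ≡-Reasoning

  move-opposite : ∀ o (i : Fin N) → move (opposite o) (move o i) ≡ i
  move-opposite fw = prev-next
  move-opposite bw = next-prev

  move-injective : ∀ o {i j : Fin N} → move o i ≡ move o j → i ≡ j
  move-injective o {i} {j} e =
    trans (sym (move-opposite o i)) (trans (cong (move (opposite o)) e) (move-opposite o j))

  move^-move : ∀ o k (i : Fin N) → move^ o k (move o i) ≡ move o (move^ o k i)
  move^-move o zero i = refl
  move^-move o (suc k) i = cong (move o) (move^-move o k i)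

  move^-+ : ∀ o a b (i : Fin N) → move^ o (a + b) i ≡ move^ o a (move^ o b i)
  move^-+ o zero b i = refl
  move^-+ o (suc a) b i = cong (move o) (move^-+ o a b i)

  move^-opposite : ∀ o k (i : Fin N) → move^ (opposite o) k (move^ o k i) ≡ i
  move^-opposite o zero i = refl
  move^-opposite o (suc k) i = begin
    move (opposite o) (move^ (opposite o) k (move o (move^ o k i)))
      ≡⟨ move^-move (opposite o) k _ ⟨
    move^ (opposite o) k (move (opposite o) (move o (move^ o k i)))
      ≡⟨ cong (move^ (opposite o) k) (move-opposite o _) ⟩
    move^ (opposite o) k (move^ o k i)
      ≡⟨ move^-opposite o k i ⟩
    i ∎
    where open ≡-Reasoning

  move^-N : ∀ o (i : Fin N) → move^ o N i ≡ i
  move^-N fw i = toℕ-injective (trans (toℕ-move^-fw N i) (toℕ+N%N i))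
  move^-N bw i = trans (cong (move^ bw N) (sym (move^-N fw i))) (move^-opposite fw N i)

  move^-fixed-point-free : ∀ o d (i : Fin N) → 0 < d → d < N → move^ o d i ≢ i
  move^-fixed-point-free fw d i 0<d d<N e with toℕ i + d <? N
  ... | yes t+d<N = <-irrefl (sym (trans (sym (m<n⇒m%n≡m t+d<N)) t+d%N≡t)) (m<m+n (toℕ i) 0<d)
    where
    t+d%N≡t : (toℕ i + d) % N ≡ toℕ i
    t+d%N≡t = trans (sym (toℕ-move^-fw d i)) (cong toℕ e)
  ... | no t+d≮N = <-irrefl r≡t r<t
    where
    t = toℕ i
    r = t + d ∸ N
    t+d≡r+N : t + d ≡ r + N
    t+d≡r+N = sym (m∸n+n≡m (≮⇒≥ t+d≮N))
    r<t : r < t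
    r<t = +-cancelʳ-< _ _ _ (subst (_< t + N) t+d≡r+N (+-monoʳ-< t d<N))
    r≡t : r ≡ t
    r≡t = begin
      r              ≡⟨ m<n⇒m%n≡m (<-trans r<t (toℕ<n i)) ⟨
      r % N          ≡⟨ [m+n]%n≡m%n r N ⟨
      (r + N) % N    ≡⟨ cong (_% N) t+d≡r+N ⟨
      (t + d) % N    ≡⟨ toℕ-move^-fw d i ⟨
      toℕ (move^ fw d i) ≡⟨ cong toℕ e ⟩
      t              ∎
      where open ≡-Reasoning
  move^-fixed-point-free bw d i 0<d d<N e =
    move^-fixed-point-free fw d i 0<d d<N
      (trans (cong (move^ fw d) (sym e)) (move^-opposite bw d i))

  move^-distinct : ∀ o (i : Fin N) {a b} → a < b → b < N → move^ o b i ≢ move^ o a i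
  move^-distinct o i {a} {b} a<b b<N e =
    move^-fixed-point-free o (b ∸ a) (move^ o a i) (m<n⇒0<n∸m a<b) (≤-<-trans (m∸n≤m b a) b<N)
      (trans (sym (move^-+ o (b ∸ a) a i)) (trans (cong (λ z → move^ o z i) (m∸n+n≡m (<⇒≤ a<b))) e))

  move^-injectiveˡ : ∀ o (i : Fin N) {a b} → a < N → b < N → move^ o a i ≡ move^ o b i → a ≡ b
  move^-injectiveˡ o i {a} {b} a<N b<N e with <-cmp a b
  ... | tri≈ _ a≡b _ = a≡b
  ... | tri< a<b _ _ = ⊥-elim (move^-distinct o i a<b b<N (sym e))
  ... | tri> _ _ b<a = ⊥-elim (move^-distinct o i b<a a<N e)

  move^-surjective : ∀ o (i j : Fin N) → Σ[ k ∈ ℕ ] k < N × move^ o k i ≡ j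
  move^-surjective fw i j = k , m%n<n (N ∸ toℕ i + toℕ j) N , toℕ-injective (begin
    toℕ (move^ fw k i)            ≡⟨ toℕ-move^-fw k i ⟩
    (t + k) % N                   ≡⟨ [m+n%N]%N≡[m+n]%N t (N ∸ t + toℕ j) ⟩
    (t + (N ∸ t + toℕ j)) % N     ≡⟨ cong (_% N) (+-assoc t (N ∸ t) (toℕ j)) ⟨
    (t + (N ∸ t) + toℕ j) % N     ≡⟨ cong (λ z → (z + toℕ j) % N) (m+[n∸m]≡n (<⇒≤ (toℕ<n i))) ⟩
    (N + toℕ j) % N               ≡⟨ cong (_% N) (+-comm N (toℕ j)) ⟩
    (toℕ j + N) % N               ≡⟨ toℕ+N%N j ⟩
    toℕ j                         ∎)
    where
    open ≡-Reasoning
    t = toℕ i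
    k = (N ∸ t + toℕ j) % N
  move^-surjective bw i j with move^-surjective fw j i
  ... | k , k<N , e = k , k<N , trans (cong (move^ bw k) (sym e)) (move^-opposite fw k j)

-- The zigzag through the annulus

twice : ℕ → ℕ
twice zero = zero
twice (suc k) = suc (suc (twice k))

data Parity : ℕ → Set where
  even : ∀ k → Parity (twice k)
  odd  : ∀ k → Parity (suc (twice k))

parity : ∀ q → Parity q
parity zero = even zero
parity (suc zero) = odd zero
parity (suc (suc q)) with parity q
... | even k = even (suc k)
... | odd k = odd (suc k)

Even : ℕ → Set
Even q = ∃[ k ] q ≡ twice k

twice-mono-< : ∀ {a b} → a < b → twice a < twice b
twice-mono-< {zero} {suc b} _ = s≤s z≤n
twice-mono-< {suc a} {suc b} (s≤s a<b) = s≤s (s≤s (twice-mono-< a<b))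

twice-mono-≤ : ∀ {a b} → a ≤ b → twice a ≤ twice b
twice-mono-≤ z≤n = z≤n
twice-mono-≤ (s≤s a≤b) = s≤s (s≤s (twice-mono-≤ a≤b))

twice-cancel-< : ∀ {a b} → twice a < twice b → a < b
twice-cancel-< {zero} {suc b} _ = s≤s z≤n
twice-cancel-< {suc a} {suc b} (s≤s (s≤s a<b)) = s≤s (twice-cancel-< a<b)

suc-twice-cancel-< : ∀ {a b} → suc (twice a) < twice b → a < b
suc-twice-cancel-< {a} lt = twice-cancel-< (<-trans (n<1+n (twice a)) lt)

twice≢suc-twice : ∀ a b → twice a ≢ suc (twice b)
twice≢suc-twice (suc a) (suc b) e = twice≢suc-twice a b (suc-injective (suc-injective e))

odd-not-even : ∀ q → ¬ Even (suc (twice q))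
odd-not-even q (k , e) = twice≢suc-twice k q (sym e)

xa-injective : ∀ {n} {u v : Fin n} → xa u ≡ xa v → u ≡ v
xa-injective refl = refl

yb-injective : ∀ {n} {u v : Fin n} → yb u ≡ yb v → u ≡ v
yb-injective refl = refl

module _ {m : ℕ} where
  private
    N = suc m

  period : ℕ
  period = twice N

  yIndex : Dir → Fin N → Fin N
  yIndex fw i = next i
  yIndex bw i = i

  yIndex-injective : ∀ o {i j : Fin N} → yIndex o i ≡ yIndex o j → i ≡ j
  yIndex-injective fw = move-injective fw
  yIndex-injective bw e = e

  -- Walking along the annulus in direction o from x_i alternately visits N_a and
  -- N_b: consecutive vertices span a type-1 edge, vertices two apart an edge of N_a or N_b.
  zigzag : Dir → Fin N → ℕ → V N
  zigzag o i zero = xa i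
  zigzag o i (suc zero) = yb (yIndex o i)
  zigzag o i (suc (suc p)) = zigzag o (move o i) p

  zigzag-shift : ∀ o k (i : Fin N) p → zigzag o i (twice k + p) ≡ zigzag o (move^ o k i) p
  zigzag-shift o zero i p = refl
  zigzag-shift o (suc k) i p =
    trans (zigzag-shift o k (move o i) p) (cong (λ j → zigzag o j p) (move^-move o k i))

  zigzag-periodic : ∀ o (i : Fin N) p → zigzag o i (period + p) ≡ zigzag o i p
  zigzag-periodic o i p = trans (zigzag-shift o N i p) (cong (λ j → zigzag o j p) (move^-N o i))

  zigzag-even : ∀ o (i : Fin N) k → zigzag o i (twice k) ≡ xa (move^ o k i)
  zigzag-even o i k = trans (cong (zigzag o i) (sym (+-identityʳ (twice k)))) (zigzag-shift o k i 0)

  zigzag-odd : ∀ o (i : Fin N) k → zigzag o i (suc (twice k)) ≡ yb (yIndex o (move^ o k i))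
  zigzag-odd o i k = trans (cong (zigzag o i) (+-comm 1 (twice k))) (zigzag-shift o k i 1)

  zigzag≢pole : ∀ o (i : Fin N) p → zigzag o i p ≢ pa
  zigzag≢pole o i p e with parity p
  ... | even k with () ← trans (sym (zigzag-even o i k)) e
  ... | odd k with () ← trans (sym (zigzag-odd o i k)) e

  zigzag-adj₁ : ∀ o (i : Fin N) p → Adj (zigzag o i p) (zigzag o i (suc p))
  zigzag-adj₁ fw i zero = xy1 i
  zigzag-adj₁ bw i zero = xy0 i
  zigzag-adj₁ fw i (suc zero) = sy (xy0 (next i))
  zigzag-adj₁ bw i (suc zero) = subst (λ z → Adj (yb z) (xa (prev i))) (next-prev i) (sy (xy1 (prev i)))
  zigzag-adj₁ o i (suc (suc p)) = zigzag-adj₁ o (move o i) p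

  zigzag-adj₂ : ∀ o (i : Fin N) p → Adj (zigzag o i p) (zigzag o i (suc (suc p)))
  zigzag-adj₂ fw i zero = xx i
  zigzag-adj₂ bw i zero = subst (λ z → Adj (xa z) (xa (prev i))) (next-prev i) (sy (xx (prev i)))
  zigzag-adj₂ fw i (suc zero) = yy (next i)
  zigzag-adj₂ bw i (suc zero) = subst (λ z → Adj (yb z) (yb (prev i))) (next-prev i) (sy (yy (prev i)))
  zigzag-adj₂ o i (suc (suc p)) = zigzag-adj₂ o (move o i) p

  pole-adj-zigzag : ∀ o (i : Fin N) k → Adj pa (zigzag o i (twice k))
  pole-adj-zigzag o i zero = ax i
  pole-adj-zigzag o i (suc k) = pole-adj-zigzag o (move o i) k

  data OrientedEdge : V N → V N → Set where
    eax : ∀ i → OrientedEdge pa (xa i)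
    exx : ∀ i → OrientedEdge (xa i) (xa (next i))
    eyy : ∀ i → OrientedEdge (yb i) (yb (next i))
    exy0 : ∀ i → OrientedEdge (xa i) (yb i)
    exy1 : ∀ i → OrientedEdge (xa i) (yb (next i))

  orient : ∀ {u v : V N} → Adj u v → OrientedEdge u v ⊎ OrientedEdge v u
  orient (ax i) = inj₁ (eax i)
  orient (xx i) = inj₁ (exx i)
  orient (yy i) = inj₁ (eyy i)
  orient (xy0 i) = inj₁ (exy0 i)
  orient (xy1 i) = inj₁ (exy1 i)
  orient (sy a) with orient a
  ... | inj₁ e = inj₂ e
  ... | inj₂ e = inj₁ e

  data XNeighbour (c : Fin N) (w : V N) : Set where
    x-pole : w ≡ pa → XNeighbour c w
    x-next : w ≡ xa (next c) → XNeighbour c w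
    x-prev : w ≡ xa (prev c) → XNeighbour c w
    x-y    : w ≡ yb c → XNeighbour c w
    x-ynext : w ≡ yb (next c) → XNeighbour c w

  x-neighbour : ∀ {c : Fin N} {w} → Adj (xa c) w → XNeighbour c w
  x-neighbour a with orient a
  ... | inj₁ (exx i) = x-next refl
  ... | inj₁ (exy0 i) = x-y refl
  ... | inj₁ (exy1 i) = x-ynext refl
  ... | inj₂ (eax i) = x-pole refl
  ... | inj₂ (exx i) = x-prev (cong xa (sym (prev-next i)))

  data YNeighbour (c : Fin N) (w : V N) : Set where
    y-next  : w ≡ yb (next c) → YNeighbour c w
    y-prev  : w ≡ yb (prev c) → YNeighbour c w
    y-x     : w ≡ xa c → YNeighbour c w
    y-xprev : w ≡ xa (prev c) → YNeighbour c w

  y-neighbour : ∀ {c : Fin N} {w} → Adj (yb c) w → YNeighbour c w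
  y-neighbour a with orient a
  ... | inj₁ (eyy i) = y-next refl
  ... | inj₂ (eyy i) = y-prev (cong yb (sym (prev-next i)))
  ... | inj₂ (exy0 i) = y-x refl
  ... | inj₂ (exy1 i) = y-xprev (cong xa (sym (prev-next i)))

  pole-neighbour : ∀ {w} → Adj (pa {N}) w → ∃[ c ] w ≡ xa c
  pole-neighbour a with orient a
  ... | inj₁ (eax i) = i , refl

  data ZigzagNeighbour (o : Dir) (i : Fin N) (q : ℕ) (w : V N) : Set where
    via-pole : w ≡ pa → Even q → ZigzagNeighbour o i q w
    before₂  : w ≡ zigzag o i q → ZigzagNeighbour o i q w
    before₁  : w ≡ zigzag o i (1 + q) → ZigzagNeighbour o i q w
    after₁   : w ≡ zigzag o i (3 + q) → ZigzagNeighbour o i q w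
    after₂   : w ≡ zigzag o i (4 + q) → ZigzagNeighbour o i q w

  zigzag-neighbour : ∀ o (i : Fin N) q {w} → Adj (zigzag o i (2 + q)) w → ZigzagNeighbour o i q w
  zigzag-neighbour fw j zero a with x-neighbour a
  ... | x-pole e = via-pole e (0 , refl)
  ... | x-next e = after₂ e
  ... | x-prev e = before₂ (trans e (cong xa (prev-next j)))
  ... | x-y e = before₁ e
  ... | x-ynext e = after₁ e
  zigzag-neighbour bw j zero a with x-neighbour a
  ... | x-pole e = via-pole e (0 , refl)
  ... | x-next e = before₂ (trans e (cong xa (next-prev j)))
  ... | x-prev e = after₂ e
  ... | x-y e = after₁ e
  ... | x-ynext e = before₁ (trans e (cong yb (next-prev j)))
  zigzag-neighbour fw j (suc zero) a with y-neighbour a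
  ... | y-next e = after₂ e
  ... | y-prev e = before₂ (trans e (cong yb (prev-next (next j))))
  ... | y-x e = after₁ e
  ... | y-xprev e = before₁ (trans e (cong xa (prev-next (next j))))
  zigzag-neighbour bw j (suc zero) a with y-neighbour a
  ... | y-next e = before₂ (trans e (cong yb (next-prev j)))
  ... | y-prev e = after₂ e
  ... | y-x e = before₁ e
  ... | y-xprev e = after₁ e
  zigzag-neighbour o i (suc (suc q)) a with zigzag-neighbour o (move o i) q a
  ... | via-pole e (k , refl) = via-pole e (suc k , refl)
  ... | before₂ e = before₂ e
  ... | before₁ e = before₁ e
  ... | after₁ e = after₁ e
  ... | after₂ e = after₂ e

  x-on-zigzag : ∀ o (i j : Fin N) → Σ[ k ∈ ℕ ] k < N × xa j ≡ zigzag o i (twice k)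
  x-on-zigzag o i j with move^-surjective o i j
  ... | k , k<N , e = k , k<N , sym (trans (zigzag-even o i k) (cong xa e))

  y-on-zigzag : ∀ o (i j : Fin N) → Σ[ k ∈ ℕ ] k < N × yb j ≡ zigzag o i (suc (twice k))
  y-on-zigzag fw i j with move^-surjective fw i (prev j)
  ... | k , k<N , e = k , k<N , sym (trans (zigzag-odd fw i k) (cong yb (trans (cong next e) (next-prev j))))
  y-on-zigzag bw i j with move^-surjective bw i j
  ... | k , k<N , e = k , k<N , sym (trans (zigzag-odd bw i k) (cong yb e))

  zigzag-covers : ∀ o (i : Fin N) (u : V N) → u ≢ pa → Σ[ p ∈ ℕ ] p < period × u ≡ zigzag o i p
  zigzag-covers o i pa u≢pa = ⊥-elim (u≢pa refl)
  zigzag-covers o i (xa c) _ with x-on-zigzag o i c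
  ... | k , k<N , e = twice k , twice-mono-< k<N , e
  zigzag-covers o i (yb c) _ with y-on-zigzag o i c
  ... | k , k<N , e = suc (twice k) , twice-mono-≤ k<N , e

  zigzag-injective : ∀ o (i : Fin N) {p q} → p < period → q < period → zigzag o i p ≡ zigzag o i q → p ≡ q
  zigzag-injective o i {p} {q} p< q< e with parity p | parity q
  ... | even a | even b = cong twice (move^-injectiveˡ o i (twice-cancel-< p<) (twice-cancel-< q<)
          (xa-injective (trans (sym (zigzag-even o i a)) (trans e (zigzag-even o i b)))))
  ... | even a | odd b with () ← trans (sym (zigzag-even o i a)) (trans e (zigzag-odd o i b))
  ... | odd a | even b with () ← trans (sym (zigzag-odd o i a)) (trans e (zigzag-even o i b))
  ... | odd a | odd b = cong (λ z → suc (twice z)) (move^-injectiveˡ o i (suc-twice-cancel-< p<) (suc-twice-cancel-< q<)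
          (yIndex-injective o (yb-injective (trans (sym (zigzag-odd o i a)) (trans e (zigzag-odd o i b))))))

_≟ᵛ_ : ∀ {n} (u v : V n) → Dec (u ≡ v)
pa ≟ᵛ pa = yes refl
pa ≟ᵛ xa _ = no (λ ())
pa ≟ᵛ yb _ = no (λ ())
xa _ ≟ᵛ pa = no (λ ())
xa i ≟ᵛ xa j with i ≟ᶠ j
... | yes refl = yes refl
... | no i≢j = no (λ e → i≢j (xa-injective e))
xa _ ≟ᵛ yb _ = no (λ ())
yb _ ≟ᵛ pa = no (λ ())
yb _ ≟ᵛ xa _ = no (λ ())
yb i ≟ᵛ yb j with i ≟ᶠ j
... | yes refl = yes refl
... | no i≢j = no (λ e → i≢j (yb-injective e))

module _ {A : Set} where

  members-of-pair : ∀ {xs : List A} {a b x} → length xs ≡ 2 → a ∈ xs → b ∈ xs → a ≢ b →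
                    x ∈ xs → x ≡ a ⊎ x ≡ b
  members-of-pair {_ ∷ _ ∷ []} refl (here refl) (here refl) a≢b _ = ⊥-elim (a≢b refl)
  members-of-pair {_ ∷ _ ∷ []} refl (there (here refl)) (there (here refl)) a≢b _ = ⊥-elim (a≢b refl)
  members-of-pair {_ ∷ _ ∷ []} refl (here refl) (there (here refl)) _ (here refl) = inj₁ refl
  members-of-pair {_ ∷ _ ∷ []} refl (here refl) (there (here refl)) _ (there (here refl)) = inj₂ refl
  members-of-pair {_ ∷ _ ∷ []} refl (there (here refl)) (here refl) _ (here refl) = inj₂ refl
  members-of-pair {_ ∷ _ ∷ []} refl (there (here refl)) (here refl) _ (there (here refl)) = inj₁ refl

  no-three-in-pair : ∀ {a b u v w : A} → u ≡ a ⊎ u ≡ b → v ≡ a ⊎ v ≡ b → w ≡ a ⊎ w ≡ b →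
                     u ≢ v → u ≢ w → v ≢ w → ⊥
  no-three-in-pair (inj₁ refl) (inj₁ refl) _ u≢v _ _ = u≢v refl
  no-three-in-pair (inj₂ refl) (inj₂ refl) _ u≢v _ _ = u≢v refl
  no-three-in-pair (inj₁ refl) _ (inj₁ refl) _ u≢w _ = u≢w refl
  no-three-in-pair (inj₂ refl) _ (inj₂ refl) _ u≢w _ = u≢w refl
  no-three-in-pair _ (inj₁ refl) (inj₁ refl) _ _ v≢w = v≢w refl
  no-three-in-pair _ (inj₂ refl) (inj₂ refl) _ _ v≢w = v≢w refl

  unique-pair-length : ∀ {xs : List A} {a b} → Unique xs → a ∈ xs → b ∈ xs → a ≢ b →
                       (∀ {x} → x ∈ xs → x ≡ a ⊎ x ≡ b) → length xs ≡ 2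
  unique-pair-length {_ ∷ []} _ (here refl) (here refl) a≢b _ = ⊥-elim (a≢b refl)
  unique-pair-length {_ ∷ _ ∷ []} _ _ _ _ _ = refl
  unique-pair-length {_ ∷ _ ∷ _ ∷ _} ((u≢v ∷ u≢w ∷ _) ∷ (v≢w ∷ _) ∷ _) _ _ _ only =
    ⊥-elim (no-three-in-pair (only (here refl)) (only (there (here refl)))
                             (only (there (there (here refl)))) u≢v u≢w v≢w)

  module _ {P : A → Set} (P? : Decidable P) where

    count≡2-exhaustive : ∀ {xs : List A} {a b x} → length (filter P? xs) ≡ 2 →
                         a ∈ xs → b ∈ xs → a ≢ b → P a → P b → x ∈ xs → P x → x ≡ a ⊎ x ≡ b
    count≡2-exhaustive len a∈ b∈ a≢b Pa Pb x∈ Px =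
      members-of-pair len (∈-filter⁺ P? a∈ Pa) (∈-filter⁺ P? b∈ Pb) a≢b (∈-filter⁺ P? x∈ Px)

    count≡2 : ∀ {xs : List A} {a b} → Unique xs → a ∈ xs → b ∈ xs → a ≢ b → P a → P b →
              (∀ {x} → x ∈ xs → P x → x ≡ a ⊎ x ≡ b) → length (filter P? xs) ≡ 2
    count≡2 uniq a∈ b∈ a≢b Pa Pb only =
      unique-pair-length (filter⁺ P? uniq) (∈-filter⁺ P? a∈ Pa) (∈-filter⁺ P? b∈ Pb) a≢b
        (λ x∈ → let x∈xs , px = ∈-filter⁻ P? x∈ in only x∈xs px)

∈-allTE : ∀ {n} (e : TE n) → e ∈ allTE n
∈-allTE {n} (te0 j) = ∈-++⁺ˡ (∈-map⁺ te0 (∈-allFin j))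
∈-allTE {n} (te1 j) = ∈-++⁺ʳ (map te0 (allFin n)) (∈-map⁺ te1 (∈-allFin j))

allTE-unique : ∀ n → Unique (allTE n)
allTE-unique n = ++⁺ (map⁺ te0-injective (allFin⁺ n)) (map⁺ te1-injective (allFin⁺ n)) disjoint
  where
  te0-injective : ∀ {i j : _} → te0 {n} i ≡ te0 j → i ≡ j
  te0-injective refl = refl
  te1-injective : ∀ {i j : _} → te1 {n} i ≡ te1 j → i ≡ j
  te1-injective refl = refl
  disjoint : ∀ {e} → ¬ (e ∈ map te0 (allFin n) × e ∈ map te1 (allFin n))
  disjoint (∈₀ , ∈₁) with ∈-map⁻ te0 ∈₀ | ∈-map⁻ te1 ∈₁
  ... | _ , _ , refl | _ , _ , ()

Joins : ∀ {n} → V n × V n → V n → V n → Set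
Joins p u v = p ≡ (u , v) ⊎ p ≡ (v , u)

te0-injective : ∀ {n} {c c′ : Fin n} → te0 c ≡ te0 c′ → c ≡ c′
te0-injective refl = refl

te1-injective : ∀ {n} {c c′ : Fin n} → te1 c ≡ te1 c′ → c ≡ c′
te1-injective refl = refl

module _ {m : ℕ} where
  private
    N = suc m

  move-opposite⁻ : ∀ o (i : Fin N) → move o (move (opposite o) i) ≡ i
  move-opposite⁻ fw = next-prev
  move-opposite⁻ bw = prev-next

  edge₀ : Dir → Fin N → TE N
  edge₀ fw j = te1 j
  edge₀ bw j = te0 j

  edge₁ : Dir → Fin N → TE N
  edge₁ fw j = te0 (next j)
  edge₁ bw j = te1 (prev j)

  zigzagEdge : Dir → Fin N → ℕ → TE N
  zigzagEdge o i zero = edge₀ o i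
  zigzagEdge o i (suc zero) = edge₁ o i
  zigzagEdge o i (suc (suc p)) = zigzagEdge o (move o i) p

  zigzagEdge-shift : ∀ o k (i : Fin N) p → zigzagEdge o i (twice k + p) ≡ zigzagEdge o (move^ o k i) p
  zigzagEdge-shift o zero i p = refl
  zigzagEdge-shift o (suc k) i p =
    trans (zigzagEdge-shift o k (move o i) p) (cong (λ j → zigzagEdge o j p) (move^-move o k i))

  ends-edge₀ : ∀ o (j : Fin N) → ends (edge₀ o j) ≡ (zigzag o j 0 , zigzag o j 1)
  ends-edge₀ fw j = refl
  ends-edge₀ bw j = refl

  ends-zigzagEdge : ∀ o (i : Fin N) p → Joins (ends (zigzagEdge o i p)) (zigzag o i p) (zigzag o i (suc p))
  ends-zigzagEdge o i zero = inj₁ (ends-edge₀ o i)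
  ends-zigzagEdge fw i (suc zero) = inj₂ refl
  ends-zigzagEdge bw i (suc zero) = inj₂ (cong (λ j → xa (prev i) , yb j) (next-prev i))
  ends-zigzagEdge o i (suc (suc p)) = ends-zigzagEdge o (move o i) p

  faces-zigzagEdge : ∀ o (i : Fin N) q → Joins (faces (zigzagEdge o i (suc q))) (zigzag o i q) (zigzag o i (3 + q))
  faces-zigzagEdge fw i zero = inj₁ (cong (λ j → xa j , yb (next (next i))) (prev-next i))
  faces-zigzagEdge bw i zero = inj₂ (cong (λ j → yb (prev i) , xa j) (next-prev i))
  faces-zigzagEdge fw i (suc zero) = inj₁ refl
  faces-zigzagEdge bw i (suc zero) = inj₂ (cong (λ j → xa (prev (prev i)) , yb j) (next-prev i))
  faces-zigzagEdge o i (suc (suc q)) = faces-zigzagEdge o (move o i) q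

  x-index : TE N → Fin N
  x-index (te0 j) = j
  x-index (te1 j) = j

  edge-after : ∀ o (j : Fin N) e → move o j ≡ x-index e → e ≡ edge₁ o j ⊎ e ≡ edge₀ o (move o j)
  edge-after fw j (te0 _) refl = inj₁ refl
  edge-after fw j (te1 _) refl = inj₂ refl
  edge-after bw j (te0 _) refl = inj₂ refl
  edge-after bw j (te1 _) refl = inj₁ refl

  edge-on-zigzag : ∀ o (i : Fin N) (e : TE N) → Σ[ q ∈ ℕ ] q < period × e ≡ zigzagEdge o i (suc q)
  edge-on-zigzag o i e with move^-surjective o i (move (opposite o) (x-index e))
  ... | k , k<N , hit with edge-after o (move^ o k i) e (trans (cong (move o) hit) (move-opposite⁻ o _))
  ... | inj₁ e≡ = twice k , twice-mono-< k<N , (begin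
    e                                    ≡⟨ e≡ ⟩
    zigzagEdge o (move^ o k i) 1         ≡⟨ zigzagEdge-shift o k i 1 ⟨
    zigzagEdge o i (twice k + 1)         ≡⟨ cong (zigzagEdge o i) (+-comm (twice k) 1) ⟩
    zigzagEdge o i (suc (twice k))       ∎)
    where open ≡-Reasoning
  ... | inj₂ e≡ = suc (twice k) , twice-mono-≤ k<N , (begin
    e                                            ≡⟨ e≡ ⟩
    zigzagEdge o (move^ o (suc k) i) 0           ≡⟨ zigzagEdge-shift o (suc k) i 0 ⟨
    zigzagEdge o i (twice (suc k) + 0)           ≡⟨ cong (zigzagEdge o i) (+-identityʳ (twice (suc k))) ⟩
    zigzagEdge o i (suc (suc (twice k)))         ∎)
    where open ≡-Reasoning

  edge₀-injective : ∀ o {j j′ : Fin N} → edge₀ o j ≡ edge₀ o j′ → j ≡ j′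
  edge₀-injective fw refl = refl
  edge₀-injective bw refl = refl

  edge₁-injective : ∀ o {j j′ : Fin N} → edge₁ o j ≡ edge₁ o j′ → j ≡ j′
  edge₁-injective fw e = move-injective fw (te0-injective e)
  edge₁-injective bw e = move-injective bw (te1-injective e)

  zigzagEdge-even-injective : ∀ o (i : Fin N) {a b} → twice a < period → twice b < period →
                              zigzagEdge o i (twice a) ≡ zigzagEdge o i (twice b) → a ≡ b
  zigzagEdge-even-injective o i {a} {b} a< b< e =
    move^-injectiveˡ o i (twice-cancel-< a<) (twice-cancel-< b<) (edge₀-injective o (begin
      edge₀ o (move^ o a i)          ≡⟨ zigzagEdge-shift o a i 0 ⟨
      zigzagEdge o i (twice a + 0)   ≡⟨ cong (zigzagEdge o i) (+-identityʳ (twice a)) ⟩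
      zigzagEdge o i (twice a)       ≡⟨ e ⟩
      zigzagEdge o i (twice b)       ≡⟨ cong (zigzagEdge o i) (+-identityʳ (twice b)) ⟨
      zigzagEdge o i (twice b + 0)   ≡⟨ zigzagEdge-shift o b i 0 ⟩
      edge₀ o (move^ o b i)          ∎))
    where open ≡-Reasoning

  zigzagEdge-odd-injective : ∀ o (i : Fin N) {a b} → twice a < period → twice b < period →
                             zigzagEdge o i (suc (twice a)) ≡ zigzagEdge o i (suc (twice b)) → a ≡ b
  zigzagEdge-odd-injective o i {a} {b} a< b< e =
    move^-injectiveˡ o i (twice-cancel-< a<) (twice-cancel-< b<) (edge₁-injective o (begin
      edge₁ o (move^ o a i)          ≡⟨ zigzagEdge-shift o a i 1 ⟨
      zigzagEdge o i (twice a + 1)   ≡⟨ cong (zigzagEdge o i) (+-comm (twice a) 1) ⟩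
      zigzagEdge o i (suc (twice a)) ≡⟨ e ⟩
      zigzagEdge o i (suc (twice b)) ≡⟨ cong (zigzagEdge o i) (+-comm (twice b) 1) ⟨
      zigzagEdge o i (twice b + 1)   ≡⟨ zigzagEdge-shift o b i 1 ⟩
      edge₁ o (move^ o b i)          ∎))
    where open ≡-Reasoning

cycle3 : Colour → Colour → Colour → ℕ → Colour
cycle3 a b c zero = a
cycle3 a b c (suc zero) = b
cycle3 a b c (suc (suc zero)) = c
cycle3 a b c (suc (suc (suc q))) = cycle3 a b c q

cycle3-periodic : ∀ a b c R x → cycle3 a b c (R * 3 + x) ≡ cycle3 a b c x
cycle3-periodic a b c zero x = refl
cycle3-periodic a b c (suc R) x = cycle3-periodic a b c R x

cycle3-values : ∀ a b c r → cycle3 a b c r ≡ a ⊎ cycle3 a b c r ≡ b ⊎ cycle3 a b c r ≡ c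
cycle3-values a b c zero = inj₁ refl
cycle3-values a b c (suc zero) = inj₂ (inj₁ refl)
cycle3-values a b c (suc (suc zero)) = inj₂ (inj₂ refl)
cycle3-values a b c (suc (suc (suc r))) = cycle3-values a b c r

record Pattern : Set where
  constructor mkPattern
  field t0 t1 t2 t3 t4 t5 t6 t7 a b c : Colour

patternAt : Pattern → ℕ → Colour
patternAt P 0 = Pattern.t0 P
patternAt P 1 = Pattern.t1 P
patternAt P 2 = Pattern.t2 P
patternAt P 3 = Pattern.t3 P
patternAt P 4 = Pattern.t4 P
patternAt P 5 = Pattern.t5 P
patternAt P 6 = Pattern.t6 P
patternAt P 7 = Pattern.t7 P
patternAt P (suc (suc (suc (suc (suc (suc (suc (suc q)))))))) =
  cycle3 (Pattern.a P) (Pattern.b P) (Pattern.c P) q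

Distinct3 : Colour → Colour → Colour → Set
Distinct3 x y z = x ≢ y × x ≢ z

Distinct3-transport : ∀ {x y z x′ y′ z′} → x ≡ x′ → y ≡ y′ → z ≡ z′ → Distinct3 x′ y′ z′ → Distinct3 x y z
Distinct3-transport refl refl refl d = d

record LocallyProper (P : Pattern) : Set where
  constructor mkLocallyProper
  open Pattern P
  field w0 : Distinct3 t0 t1 t2
        w1 : Distinct3 t1 t2 t3
        w2 : Distinct3 t2 t3 t4
        w3 : Distinct3 t3 t4 t5
        w4 : Distinct3 t4 t5 t6
        w5 : Distinct3 t5 t6 t7
        w6 : Distinct3 t6 t7 a
        w7 : Distinct3 t7 a b
        wa : Distinct3 a b c
        wb : Distinct3 b c a
        wc : Distinct3 c a b
        seam₁ : Distinct3 b c t0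
        seam₂ : Distinct3 c t0 t1

module FollowsPattern (col : ℕ → Colour) (P : Pattern) (R : ℕ) (L : ℕ) (L≡ : L ≡ 14 + R * 3)
                      (follows : ∀ p → p < L → col p ≡ patternAt P p)
                      (col-periodic : ∀ p → col (L + p) ≡ col p) where
  open Pattern P

  13<L : 13 < L
  13<L = subst (13 <_) (sym L≡) (s≤s (m≤m+n 13 (R * 3)))

  instance
    L-nonZero : NonZero L
    L-nonZero = >-nonZero (<-trans (s≤s z≤n) 13<L)

  <14⇒<L : ∀ {p} → p < 14 → p < L
  <14⇒<L h = <-≤-trans h 13<L

  follows<14 : ∀ p → p < 14 → col p ≡ patternAt P p
  follows<14 p h = follows p (<14⇒<L h)

  tail<L : ∀ {r} → r < 6 + R * 3 → 8 + r < L
  tail<L {r} h = subst (8 + r <_) (sym L≡) (+-monoʳ-< 8 h)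

  col-tail : ∀ r → r < 6 + R * 3 → col (8 + r) ≡ cycle3 a b c r
  col-tail r h = follows (8 + r) (tail<L h)

  col-tail-end : ∀ x → x < 6 → col (8 + (R * 3 + x)) ≡ cycle3 a b c x
  col-tail-end x x<6 = trans (col-tail (R * 3 + x) (subst (R * 3 + x <_) (+-comm (R * 3) 6) (+-monoʳ-< (R * 3) x<6)))
                             (cycle3-periodic a b c R x)

  col-periodic* : ∀ t x → col (t * L + x) ≡ col x
  col-periodic* zero x = refl
  col-periodic* (suc t) x = trans (cong col (+-assoc L (t * L) x))
      (trans (col-periodic (t * L + x)) (col-periodic* t x))

  col-mod : ∀ k p → col (k + p) ≡ col (k + p % L)
  col-mod k p = trans (cong col k+p≡) (col-periodic* (p / L) (k + p % L))
    where
    open ≡-Reasoning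
    k+p≡ : k + p ≡ p / L * L + (k + p % L)
    k+p≡ = begin
      k + p                      ≡⟨ cong (k +_) (trans (m≡m%n+[m/n]*n p L) (+-comm (p % L) (p / L * L))) ⟩
      k + (p / L * L + p % L)    ≡⟨ +-assoc k (p / L * L) (p % L) ⟨
      k + p / L * L + p % L      ≡⟨ cong (_+ p % L) (+-comm k (p / L * L)) ⟩
      p / L * L + k + p % L      ≡⟨ +-assoc (p / L * L) k (p % L) ⟩
      p / L * L + (k + p % L)    ∎

  col-L : col L ≡ t0
  col-L = trans (cong col (sym (+-identityʳ L))) (trans (col-periodic 0) (follows<14 0 (<-fromᵇ 0 14)))

  col-1+L : col (1 + L) ≡ t1
  col-1+L = trans (cong col (+-comm 1 L)) (trans (col-periodic 1) (follows<14 1 (<-fromᵇ 1 14)))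

  tail-values : ∀ p → p < L → 8 ≤ p → col p ≡ a ⊎ col p ≡ b ⊎ col p ≡ c
  tail-values p p<L 8≤p with p ∸ 8 | m+[n∸m]≡n 8≤p
  ... | r | refl with cycle3-values a b c r
  ... | inj₁ e = inj₁ (trans (follows _ p<L) e)
  ... | inj₂ (inj₁ e) = inj₂ (inj₁ (trans (follows _ p<L) e))
  ... | inj₂ (inj₂ e) = inj₂ (inj₂ (trans (follows _ p<L) e))

  tail-avoids : ∀ {x} → a ≢ x → b ≢ x → c ≢ x → ∀ p → p < L → 8 ≤ p → col p ≢ x
  tail-avoids a≢x b≢x c≢x p p<L 8≤p e with tail-values p p<L 8≤p
  ... | inj₁ e′ = a≢x (trans (sym e′) e)
  ... | inj₂ (inj₁ e′) = b≢x (trans (sym e′) e)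
  ... | inj₂ (inj₂ e′) = c≢x (trans (sym e′) e)

  follows-prefix : ∀ p → {T (p <ᵇ 14)} → col p ≡ patternAt P p
  follows-prefix p {h} = follows<14 p (<-fromᵇ p 14 {h})

  seam₁-colours : col (8 + (4 + R * 3)) ≡ b × col (9 + (4 + R * 3)) ≡ c × col (10 + (4 + R * 3)) ≡ t0
  seam₁-colours = trans (cong (λ z → col (8 + z)) (+-comm 4 (R * 3))) (col-tail-end 4 (<-fromᵇ 4 6)) ,
                  trans (cong (λ z → col (8 + z)) (+-comm 5 (R * 3))) (col-tail-end 5 (<-fromᵇ 5 6)) ,
                  trans (cong col (sym L≡)) col-L

  col-14+R*3 : col (15 + R * 3) ≡ t1
  col-14+R*3 = trans (cong (λ z → col (suc z)) (sym L≡)) col-1+L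

  module _ (proper : LocallyProper P) where
    open LocallyProper proper

    cycle3-windows : ∀ r → Distinct3 (cycle3 a b c r) (cycle3 a b c (1 + r)) (cycle3 a b c (2 + r))
    cycle3-windows zero = wa
    cycle3-windows (suc zero) = wb
    cycle3-windows (suc (suc zero)) = wc
    cycle3-windows (suc (suc (suc r))) = cycle3-windows r

    prefix-window : ∀ p → {T (2 + p <ᵇ 14)} →
                    Distinct3 (patternAt P p) (patternAt P (1 + p)) (patternAt P (2 + p)) →
                    Distinct3 (col p) (col (1 + p)) (col (2 + p))
    prefix-window p {h} = Distinct3-transport (follows<14 p p<14) (follows<14 (1 + p) 1+p<14)
        (follows<14 (2 + p) 2+p<14)
      where
      2+p<14 = <-fromᵇ (2 + p) 14 {h}
      1+p<14 = <-trans (n<1+n (1 + p)) 2+p<14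
      p<14 = <-trans (n<1+n p) 1+p<14

    windows<L : ∀ p → p < L → Distinct3 (col p) (col (1 + p)) (col (2 + p))
    windows<L 0 _ = prefix-window 0 w0
    windows<L 1 _ = prefix-window 1 w1
    windows<L 2 _ = prefix-window 2 w2
    windows<L 3 _ = prefix-window 3 w3
    windows<L 4 _ = prefix-window 4 w4
    windows<L 5 _ = prefix-window 5 w5
    windows<L 6 _ = prefix-window 6 w6
    windows<L 7 _ = prefix-window 7 w7
    windows<L (suc (suc (suc (suc (suc (suc (suc (suc r)))))))) 8+r<L with <-cmp r (4 + R * 3)
    ... | tri< r< _ _ =
      Distinct3-transport (col-tail r (<-trans r< (<-trans (n<1+n _) (n<1+n _))))
                          (col-tail (1 + r) (<-trans (s≤s r<) (n<1+n _)))
                          (col-tail (2 + r) (s≤s (s≤s r<)))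
                       (cycle3-windows r)
    ... | tri≈ _ refl _ = let e₁ , e₂ , e₃ = seam₁-colours in Distinct3-transport e₁ e₂ e₃ seam₁
    ... | tri> _ _ r> with ≤-antisym (+-cancelˡ-≤ 9 r (5 + R * 3) (subst (9 + r ≤_) L≡ 8+r<L)) r>
    ... | refl = let _ , e₂ , e₃ = seam₁-colours in Distinct3-transport e₂ e₃ col-14+R*3 seam₂

    windows : ∀ p → Distinct3 (col p) (col (1 + p)) (col (2 + p))
    windows p = Distinct3-transport (col-mod 0 p) (col-mod 1 p) (col-mod 2 p)
                       (windows<L (p % L) (m%n<n p L))

InC12 : Colour → Set
InC12 = InC c1 c2

InC34 : Colour → Set
InC34 = InC c3 c4

Joins-InC12 : ∀ {n} {C : Map n} {e : TE n} {u v} → Joins (ends e) u v →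
              InC12 (C u) → InC12 (C v) → EdgeIn12 C e
Joins-InC12 (inj₁ refl) cu cv = cu , cv
Joins-InC12 (inj₂ refl) cu cv = cv , cu

EdgeIn12-Joins : ∀ {n} {C : Map n} {e : TE n} {u v} → Joins (ends e) u v →
                 EdgeIn12 C e → InC12 (C u) × InC12 (C v)
EdgeIn12-Joins (inj₁ refl) (cu , cv) = cu , cv
EdgeIn12-Joins (inj₂ refl) (cv , cu) = cu , cv

Joins-Nonsingular : ∀ {n} {C : Map n} {e : TE n} {u v} → Joins (faces e) u v →
                    C u ≢ C v → Nonsingular C e
Joins-Nonsingular (inj₁ refl) cu≢cv = cu≢cv
Joins-Nonsingular (inj₂ refl) cu≢cv = λ e → cu≢cv (sym e)

Nonsingular-Joins : ∀ {n} {C : Map n} {e : TE n} {u v} → Joins (faces e) u v →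
                    Nonsingular C e → C u ≢ C v
Nonsingular-Joins (inj₁ refl) ns = ns
Nonsingular-Joins (inj₂ refl) ns = λ e → ns (sym e)

two-vertex-chain : ∀ {n} (C : Map n) (e : TE n) {u v : V n} → ends e ≡ (u , v) →
                   InC34 (C u) → InC34 (C v) →
                   (∀ w → Adj u w → InC34 (C w) → w ≡ u ⊎ w ≡ v) →
                   (∀ w → Adj v w → InC34 (C w) → w ≡ u ⊎ w ≡ v) → ChainOf34 C e
two-vertex-chain C e {u} {v} refl cu cv u-closed v-closed = cu , cv , λ w → closed (inj₁ refl)
  where
  closed : ∀ {x w} → x ≡ u ⊎ x ≡ v → Path C c3 c4 x w → w ≡ u ⊎ w ≡ v
  closed x∈ here = x∈
  closed (inj₁ refl) (step _ a cw p) = closed (u-closed _ a cw) p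
  closed (inj₂ refl) (step _ a cw p) = closed (v-closed _ a cw) p

module ZigzagPattern {m : ℕ} (o : Dir) (i : Fin (suc m)) (P : Pattern) (R : ℕ)
                     (period≡ : period {m} ≡ 14 + R * 3)
                     (C : Map (suc m)) (C-pole : C pa ≡ c1)
                     (follows : ∀ p → p < period {m} → C (zigzag o i p) ≡ patternAt P p) where
  open Pattern P

  col : ℕ → Colour
  col p = C (zigzag o i p)

  open FollowsPattern col P R (period {m}) period≡ follows (λ p → cong C (zigzag-periodic o i p)) public

  record EvenAvoids1 : Set where
    field t0≢1 : t0 ≢ c1
          t2≢1 : t2 ≢ c1
          t4≢1 : t4 ≢ c1
          t6≢1 : t6 ≢ c1
          a≢1  : a ≢ c1
          b≢1  : b ≢ c1
          c≢1  : c ≢ c1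

  module Proper (locally-proper : LocallyProper P) (even-avoids-1 : EvenAvoids1) where
    open EvenAvoids1 even-avoids-1

    even≢1 : ∀ k → twice k < period {m} → col (twice k) ≢ c1
    even≢1 0 _ e = t0≢1 (trans (sym (follows-prefix 0)) e)
    even≢1 1 _ e = t2≢1 (trans (sym (follows-prefix 2)) e)
    even≢1 2 _ e = t4≢1 (trans (sym (follows-prefix 4)) e)
    even≢1 3 _ e = t6≢1 (trans (sym (follows-prefix 6)) e)
    even≢1 (suc (suc (suc (suc k)))) h = tail-avoids a≢1 b≢1 c≢1 _ h (+-monoʳ-≤ 8 z≤n)

    pole-proper : ∀ v → Adj pa v → C pa ≢ C v
    pole-proper v a e with pole-neighbour a
    ... | c , refl with x-on-zigzag o i c
    ... | k , k<N , x≡ = even≢1 k (twice-mono-< k<N) (trans (cong C (sym x≡)) (trans (sym e) C-pole))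

    -- Position period + p is at least 2, so its neighbours are described by zigzag-neighbour.
    zigzag-proper : ∀ p v → Adj (zigzag o i (period {m} + p)) v → v ≢ pa → col (period {m} + p) ≢ C v
    zigzag-proper p v a v≢pa with zigzag-neighbour o i (twice m + p) a
    ... | via-pole v≡pa _ = ⊥-elim (v≢pa v≡pa)
    ... | before₂ refl = λ e → proj₂ (windows locally-proper (twice m + p)) (sym e)
    ... | before₁ refl = λ e → proj₁ (windows locally-proper (suc (twice m + p))) (sym e)
    ... | after₁ refl = proj₁ (windows locally-proper (2 + (twice m + p)))
    ... | after₂ refl = proj₂ (windows locally-proper (2 + (twice m + p)))

    off-pole : ∀ u v → Adj u v → u ≢ pa → v ≢ pa → C u ≢ C v
    off-pole u v a u≢pa v≢pa with zigzag-covers o i u u≢pa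
    ... | p , _ , refl = λ e → zigzag-proper p v (subst (λ z → Adj z v) (sym (zigzag-periodic o i p)) a) v≢pa
                                  (trans (cong C (zigzag-periodic o i p)) e)

    normColouring : NormColouring C
    normColouring = proper , C-pole
      where
      proper : IsColouring C
      proper pa v a = pole-proper v a
      proper (xa _) pa a = λ e → pole-proper _ (sy a) (sym e)
      proper (yb _) pa a = λ e → pole-proper _ (sy a) (sym e)
      proper (xa _) (xa _) a = off-pole _ _ a (λ ()) (λ ())
      proper (xa _) (yb _) a = off-pole _ _ a (λ ()) (λ ())
      proper (yb _) (xa _) a = off-pole _ _ a (λ ()) (λ ())
      proper (yb _) (yb _) a = off-pole _ _ a (λ ()) (λ ())

  module CountP (a≢1 : a ≢ c1) (b≢1 : b ≢ c1) (c≢1 : c ≢ c1) (t1≢1 : t1 ≢ c1) (t5≢1 : t5 ≢ c1)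
                (t3≡1 : t3 ≡ c1) (t7≡1 : t7 ≡ c1) where

    y₃ y₇ : Fin (suc m)
    y₃ = yIndex o (move^ o 1 i)
    y₇ = yIndex o (move^ o 3 i)

    only-y₃-y₇ : ∀ {j} → C (yb j) ≡ c1 → j ≡ y₃ ⊎ j ≡ y₇
    only-y₃-y₇ {j} e with y-on-zigzag o i j
    ... | k , k<N , y≡ = at k (twice-mono-≤ k<N) (trans (cong C (sym y≡)) e) y≡
      where
      at : ∀ k → suc (twice k) < period {m} → col (suc (twice k)) ≡ c1 →
           yb j ≡ zigzag o i (suc (twice k)) → j ≡ y₃ ⊎ j ≡ y₇
      at 0 _ e′ _ = ⊥-elim (t1≢1 (trans (sym (follows-prefix 1)) e′))
      at 1 _ e′ y≡′ = inj₁ (yb-injective (trans y≡′ (zigzag-odd o i 1)))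
      at 2 _ e′ _ = ⊥-elim (t5≢1 (trans (sym (follows-prefix 5)) e′))
      at 3 _ e′ y≡′ = inj₂ (yb-injective (trans y≡′ (zigzag-odd o i 3)))
      at (suc (suc (suc (suc k)))) h e′ _ = ⊥-elim (tail-avoids a≢1 b≢1 c≢1 _ h (+-monoʳ-≤ 8 z≤n) e′)

    y₃≢y₇ : y₃ ≢ y₇
    y₃≢y₇ e with zigzag-injective o i (<14⇒<L (<-fromᵇ 3 14)) (<14⇒<L (<-fromᵇ 7 14))
                   (trans (zigzag-odd o i 1) (trans (cong yb e) (sym (zigzag-odd o i 3))))
    ... | ()

    p#≡2 : p# C ≡ 2
    p#≡2 = count≡2 (λ j → C (yb j) ≟ᶠ c1) (allFin⁺ (suc m)) (∈-allFin y₃) (∈-allFin y₇) y₃≢y₇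
             (trans (cong C (sym (zigzag-odd o i 1))) (trans (follows-prefix 3) t3≡1))
             (trans (cong C (sym (zigzag-odd o i 3))) (trans (follows-prefix 7) t7≡1))
             (λ _ → only-y₃-y₇)

  module CountD (locally-proper : LocallyProper P) (even-avoids-1 : EvenAvoids1)
                (s₁ s₂ : ℕ) (s₁< : 3 + s₁ < 14) (s₂< : 3 + s₂ < 14)
                (prefix-12-pairs : ∀ p → p < 8 → InC12 (patternAt P p) → InC12 (patternAt P (suc p)) →
                                   p ≡ suc s₁ ⊎ p ≡ suc s₂)
                (s₁-12 : InC12 (patternAt P (1 + s₁)) × InC12 (patternAt P (2 + s₁)))
                (s₂-12 : InC12 (patternAt P (1 + s₂)) × InC12 (patternAt P (2 + s₂)))
                (s₁-nonsingular : patternAt P s₁ ≢ patternAt P (3 + s₁))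
                (s₂-nonsingular : patternAt P s₂ ≢ patternAt P (3 + s₂))
                (E₁≢E₂ : zigzagEdge o i (suc s₁) ≢ zigzagEdge o i (suc s₂)) where
    open EvenAvoids1 even-avoids-1

    InC12⇒≡2 : ∀ {x} → x ≢ c1 → InC12 x → x ≡ c2
    InC12⇒≡2 x≢1 (inj₁ x≡1) = ⊥-elim (x≢1 x≡1)
    InC12⇒≡2 x≢1 (inj₂ x≡2) = x≡2

    tail-12-free : ∀ p → p < period {m} → 8 ≤ p → InC12 (col p) → InC12 (col (suc p)) → ⊥
    tail-12-free p p<L 8≤p cp cp′ = proj₁ (windows locally-proper p) (trans col-p≡2 (sym col-p′≡2))
      where
      col-p≡2 : col p ≡ c2
      col-p≡2 = InC12⇒≡2 (tail-avoids a≢1 b≢1 c≢1 p p<L 8≤p) cp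
      col-p′≡2 : col (suc p) ≡ c2
      col-p′≡2 with m≤n⇒m<n∨m≡n p<L
      ... | inj₁ p′<L = InC12⇒≡2 (tail-avoids a≢1 b≢1 c≢1 (suc p) p′<L (m≤n⇒m≤1+n 8≤p)) cp′
      ... | inj₂ refl = InC12⇒≡2 (λ e → t0≢1 (trans (sym col-L) e)) cp′

    12-pair-positions : ∀ p → p ≤ period {m} → InC12 (col p) → InC12 (col (suc p)) → p ≡ suc s₁ ⊎ p ≡ suc s₂
    12-pair-positions p p≤L cp cp′ with p <? 8
    ... | yes p<8 = prefix-12-pairs p p<8 (subst InC12 (follows<14 p (<-trans p<8 (<-fromᵇ 8 14))) cp)
                                          (subst InC12 (follows<14 (suc p) (s≤s (<-trans p<8 (<-fromᵇ 8 13)))) cp′)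
    ... | no p≮8 with m≤n⇒m<n∨m≡n p≤L
    ... | inj₁ p<L = ⊥-elim (tail-12-free p p<L (≮⇒≥ p≮8) cp cp′)
    ... | inj₂ refl with prefix-12-pairs 0 (<-fromᵇ 0 8) (subst InC12 col-L cp) (subst InC12 col-1+L cp′)
    ...   | inj₁ ()
    ...   | inj₂ ()

    E₁ E₂ : TE (suc m)
    E₁ = zigzagEdge o i (suc s₁)
    E₂ = zigzagEdge o i (suc s₂)

    edge-12 : ∀ s → 3 + s < 14 → InC12 (patternAt P (1 + s)) × InC12 (patternAt P (2 + s)) →
              EdgeIn12 C (zigzagEdge o i (suc s))
    edge-12 s s< (c₁ , c₂) =
      Joins-InC12 {C = C} (ends-zigzagEdge o i (suc s))
        (subst InC12 (sym (follows<14 (1 + s) (<-trans (n<1+n _) (<-trans (n<1+n _) s<)))) c₁)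
        (subst InC12 (sym (follows<14 (2 + s) (<-trans (n<1+n _) s<))) c₂)

    12-edge-position : ∀ e → EdgeIn12 C e → Σ[ q ∈ ℕ ] (q ≡ s₁ ⊎ q ≡ s₂) × e ≡ zigzagEdge o i (suc q)
    12-edge-position e e∈12 with edge-on-zigzag o i e
    ... | q , q<L , refl with EdgeIn12-Joins {C = C} (ends-zigzagEdge o i (suc q)) e∈12
    ... | c₁ , c₂ with 12-pair-positions (suc q) q<L c₁ c₂
    ... | inj₁ eq = q , inj₁ (suc-injective eq) , refl
    ... | inj₂ eq = q , inj₂ (suc-injective eq) , refl

    12-edges : ∀ {e} → EdgeIn12 C e → e ≡ E₁ ⊎ e ≡ E₂
    12-edges {e} e∈12 with 12-edge-position e e∈12
    ... | _ , inj₁ refl , e≡ = inj₁ e≡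
    ... | _ , inj₂ refl , e≡ = inj₂ e≡

    d≡2 : d C ≡ 2
    d≡2 = count≡2 (edgeIn12? C) (allTE-unique (suc m)) (∈-allTE E₁) (∈-allTE E₂) E₁≢E₂
            (edge-12 s₁ s₁< s₁-12) (edge-12 s₂ s₂< s₂-12) (λ _ → 12-edges)

    nonsingular-at : ∀ s → 3 + s < 14 → patternAt P s ≢ patternAt P (3 + s) →
                     Nonsingular C (zigzagEdge o i (suc s))
    nonsingular-at s s< ns = Joins-Nonsingular {C = C} (faces-zigzagEdge o i s)
      (λ e → ns (trans (sym (follows<14 s (<-trans (n<1+n _) (<-trans (n<1+n _) (<-trans (n<1+n _) s<)))))
                       (trans e (follows<14 (3 + s) s<))))

    12-edges-nonsingular : ∀ e → EdgeIn12 C e → Nonsingular C e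
    12-edges-nonsingular e e∈12 with 12-edge-position e e∈12
    ... | _ , inj₁ refl , refl = nonsingular-at s₁ s₁< s₁-nonsingular
    ... | _ , inj₂ refl , refl = nonsingular-at s₂ s₂< s₂-nonsingular

  pole∉34 : ¬ InC34 (C pa)
  pole∉34 (inj₁ e) with () ← trans (sym C-pole) e
  pole∉34 (inj₂ e) with () ← trans (sym C-pole) e

  Only34At : ℕ → ℕ → Set
  Only34At t r = r ≡ t ⊎ ¬ InC34 (col r)

  only : ∀ {t r} → Only34At t r → InC34 (col r) → zigzag o i r ≡ zigzag o i t
  only (inj₁ refl) _ = refl
  only (inj₂ r∉34) r∈34 = ⊥-elim (r∉34 r∈34)

  34-neighbour-unique : ∀ q t → Only34At t q → Only34At t (1 + q) → Only34At t (3 + q) → Only34At t (4 + q) →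
                        ∀ w → Adj (zigzag o i (2 + q)) w → InC34 (C w) → w ≡ zigzag o i t
  34-neighbour-unique q t at₀ at₁ at₃ at₄ w a w∈34 with zigzag-neighbour o i q a
  ... | via-pole refl _ = ⊥-elim (pole∉34 w∈34)
  ... | before₂ refl = only at₀ w∈34
  ... | before₁ refl = only at₁ w∈34
  ... | after₁ refl = only at₃ w∈34
  ... | after₂ refl = only at₄ w∈34

-- The canonical colourings

record Colours34 (α β : Colour) : Set where
  field
    α≢β : α ≢ β
    α≢1 : α ≢ c1
    α≢2 : α ≢ c2
    β≢1 : β ≢ c1
    β≢2 : β ≢ c2

≢1,2⇒InC34 : ∀ {x} → x ≢ c1 → x ≢ c2 → InC34 x
≢1,2⇒InC34 {Fin.zero} x≢1 _ = ⊥-elim (x≢1 refl)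
≢1,2⇒InC34 {Fin.suc Fin.zero} _ x≢2 = ⊥-elim (x≢2 refl)
≢1,2⇒InC34 {Fin.suc (Fin.suc Fin.zero)} _ _ = inj₁ refl
≢1,2⇒InC34 {Fin.suc (Fin.suc (Fin.suc Fin.zero))} _ _ = inj₂ refl

≢1,2⇒∉12 : ∀ {x} → x ≢ c1 → x ≢ c2 → ¬ InC12 x
≢1,2⇒∉12 x≢1 _ (inj₁ x≡1) = x≢1 x≡1
≢1,2⇒∉12 _ x≢2 (inj₂ x≡2) = x≢2 x≡2

≡1⇒∉34 : ∀ {x} → x ≡ c1 → ¬ InC34 x
≡1⇒∉34 refl (inj₁ ())
≡1⇒∉34 refl (inj₂ ())

≡2⇒∉34 : ∀ {x} → x ≡ c2 → ¬ InC34 x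
≡2⇒∉34 refl (inj₁ ())
≡2⇒∉34 refl (inj₂ ())

-- The colours of A along the zigzag through e₁, in the situation of Corollary 2.1.
canonical : Colour → Colour → Pattern
canonical α β = mkPattern α β c2 c1 α β c2 c1 α β c2

canonical-α↔2 : Colour → Colour → Pattern
canonical-α↔2 α β = mkPattern c2 β α c1 c2 β α c1 c2 β α

module CanonicalColouring {m : ℕ} (o : Dir) (i : Fin (suc m)) {α β : Colour} (αβ : Colours34 α β)
                 (R : ℕ) (period≡ : period {m} ≡ 14 + R * 3)
                 (C : Map (suc m)) (C-pole : C pa ≡ c1)
                 (follows : ∀ p → p < period {m} → C (zigzag o i p) ≡ patternAt (canonical α β) p) where
  open Colours34 αβ
  open ZigzagPattern o i (canonical α β) R period≡ C C-pole follows

  locally-proper : LocallyProper (canonical α β)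
  locally-proper = mkLocallyProper
    (α≢β , α≢2) (β≢2 , β≢1) ((λ ()) , ≢-sym α≢2) (≢-sym α≢1 , ≢-sym β≢1)
    (α≢β , α≢2) (β≢2 , β≢1) ((λ ()) , ≢-sym α≢2) (≢-sym α≢1 , ≢-sym β≢1)
    (α≢β , α≢2) (β≢2 , ≢-sym α≢β) (≢-sym α≢2 , ≢-sym β≢2) (β≢2 , ≢-sym α≢β) (≢-sym α≢2 , ≢-sym β≢2)

  even-avoids-1 : EvenAvoids1
  even-avoids-1 = record { t0≢1 = α≢1 ; t2≢1 = λ () ; t4≢1 = α≢1 ; t6≢1 = λ ()
                         ; a≢1 = α≢1 ; b≢1 = β≢1 ; c≢1 = λ () }

  normColouring : NormColouring C
  normColouring = Proper.normColouring locally-proper even-avoids-1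

  prefix-12-pairs : ∀ p → p < 8 → InC12 (patternAt (canonical α β) p) →
                    InC12 (patternAt (canonical α β) (suc p)) → p ≡ 2 ⊎ p ≡ 6
  prefix-12-pairs 0 _ c _ = ⊥-elim (≢1,2⇒∉12 α≢1 α≢2 c)
  prefix-12-pairs 1 _ c _ = ⊥-elim (≢1,2⇒∉12 β≢1 β≢2 c)
  prefix-12-pairs 2 _ _ _ = inj₁ refl
  prefix-12-pairs 3 _ _ c = ⊥-elim (≢1,2⇒∉12 α≢1 α≢2 c)
  prefix-12-pairs 4 _ c _ = ⊥-elim (≢1,2⇒∉12 α≢1 α≢2 c)
  prefix-12-pairs 5 _ c _ = ⊥-elim (≢1,2⇒∉12 β≢1 β≢2 c)
  prefix-12-pairs 6 _ _ _ = inj₂ refl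
  prefix-12-pairs 7 _ _ c = ⊥-elim (≢1,2⇒∉12 α≢1 α≢2 c)
  prefix-12-pairs (suc (suc (suc (suc (suc (suc (suc (suc _)))))))) p<8 _ _ = ⊥-elim (<⇒≱ p<8 (+-monoʳ-≤ 8 z≤n))

  12-edges-distinct : zigzagEdge o i 2 ≢ zigzagEdge o i 6
  12-edges-distinct e with zigzagEdge-even-injective o i {1} {3} (<14⇒<L (<-fromᵇ 2 14)) (<14⇒<L (<-fromᵇ 6 14)) e
  ... | ()

  module D = CountD locally-proper even-avoids-1 1 5 (<-fromᵇ 4 14) (<-fromᵇ 8 14) prefix-12-pairs
                    (inj₂ refl , inj₁ refl) (inj₂ refl , inj₁ refl) (≢-sym α≢β) (≢-sym α≢β) 12-edges-distinct

  good : Good C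
  good = CountP.p#≡2 α≢1 β≢1 (λ ()) β≢1 β≢1 refl refl , D.d≡2 , D.12-edges-nonsingular

  ∉34 : ∀ p → {h : _} → patternAt (canonical α β) p ≡ c1 ⊎ patternAt (canonical α β) p ≡ c2 → ¬ InC34 (col p)
  ∉34 p {h} (inj₁ e) c = ≡1⇒∉34 e (subst InC34 (follows-prefix p {h}) c)
  ∉34 p {h} (inj₂ e) c = ≡2⇒∉34 e (subst InC34 (follows-prefix p {h}) c)

  chain : ∀ e → ends e ≡ (zigzag o i 4 , zigzag o i 5) → ChainOf34 C e
  chain e ends≡ = two-vertex-chain C e ends≡
    (subst InC34 (sym (follows-prefix 4)) (≢1,2⇒InC34 α≢1 α≢2))
    (subst InC34 (sym (follows-prefix 5)) (≢1,2⇒InC34 β≢1 β≢2))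
    (λ w a c → inj₂ (34-neighbour-unique 2 5 (inj₂ (∉34 2 (inj₂ refl))) (inj₂ (∉34 3 (inj₁ refl)))
                                            (inj₁ refl) (inj₂ (∉34 6 (inj₂ refl))) w a c))
    (λ w a c → inj₁ (34-neighbour-unique 3 4 (inj₂ (∉34 3 (inj₁ refl))) (inj₁ refl)
                                            (inj₂ (∉34 6 (inj₂ refl))) (inj₂ (∉34 7 (inj₁ refl))) w a c))

module SwappedColouring {m : ℕ} (o : Dir) (i : Fin (suc m)) {α β : Colour} (αβ : Colours34 α β)
                        (R : ℕ) (period≡ : period {m} ≡ 14 + R * 3)
                        (C : Map (suc m)) (C-pole : C pa ≡ c1)
                        (follows : ∀ p → p < period {m} → C (zigzag o i p) ≡ patternAt (canonical-α↔2 α β) p) where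
  open Colours34 αβ
  open ZigzagPattern o i (canonical-α↔2 α β) R period≡ C C-pole follows

  locally-proper : LocallyProper (canonical-α↔2 α β)
  locally-proper = mkLocallyProper
    (≢-sym β≢2 , ≢-sym α≢2) (≢-sym α≢β , β≢1) (α≢1 , α≢2) ((λ ()) , ≢-sym β≢1)
    (≢-sym β≢2 , ≢-sym α≢2) (≢-sym α≢β , β≢1) (α≢1 , α≢2) ((λ ()) , ≢-sym β≢1)
    (≢-sym β≢2 , ≢-sym α≢2) (≢-sym α≢β , β≢2) (α≢2 , α≢β) (≢-sym α≢β , β≢2) (α≢2 , α≢β)

  even-avoids-1 : EvenAvoids1
  even-avoids-1 = record { t0≢1 = λ () ; t2≢1 = α≢1 ; t4≢1 = λ () ; t6≢1 = α≢1
                         ; a≢1 = λ () ; b≢1 = β≢1 ; c≢1 = α≢1 }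

  normColouring : NormColouring C
  normColouring = Proper.normColouring locally-proper even-avoids-1

  prefix-12-pairs : ∀ p → p < 8 → InC12 (patternAt (canonical-α↔2 α β) p) →
                    InC12 (patternAt (canonical-α↔2 α β) (suc p)) → p ≡ 3 ⊎ p ≡ 7
  prefix-12-pairs 0 _ _ c = ⊥-elim (≢1,2⇒∉12 β≢1 β≢2 c)
  prefix-12-pairs 1 _ c _ = ⊥-elim (≢1,2⇒∉12 β≢1 β≢2 c)
  prefix-12-pairs 2 _ c _ = ⊥-elim (≢1,2⇒∉12 α≢1 α≢2 c)
  prefix-12-pairs 3 _ _ _ = inj₁ refl
  prefix-12-pairs 4 _ _ c = ⊥-elim (≢1,2⇒∉12 β≢1 β≢2 c)
  prefix-12-pairs 5 _ c _ = ⊥-elim (≢1,2⇒∉12 β≢1 β≢2 c)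
  prefix-12-pairs 6 _ c _ = ⊥-elim (≢1,2⇒∉12 α≢1 α≢2 c)
  prefix-12-pairs 7 _ _ _ = inj₂ refl
  prefix-12-pairs (suc (suc (suc (suc (suc (suc (suc (suc _)))))))) p<8 _ _ = ⊥-elim (<⇒≱ p<8 (+-monoʳ-≤ 8 z≤n))

  12-edges-distinct : zigzagEdge o i 3 ≢ zigzagEdge o i 7
  12-edges-distinct e with zigzagEdge-odd-injective o i {1} {3} (<14⇒<L (<-fromᵇ 2 14)) (<14⇒<L (<-fromᵇ 6 14)) e
  ... | ()

  module D = CountD locally-proper even-avoids-1 2 6 (<-fromᵇ 5 14) (<-fromᵇ 9 14) prefix-12-pairs
                    (inj₁ refl , inj₂ refl) (inj₁ refl , inj₂ refl) α≢β α≢β 12-edges-distinct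

  good : Good C
  good = CountP.p#≡2 (λ ()) β≢1 α≢1 β≢1 β≢1 refl refl , D.d≡2 , D.12-edges-nonsingular

  ∉34 : ∀ p → {h : _} → patternAt (canonical-α↔2 α β) p ≡ c1 ⊎ patternAt (canonical-α↔2 α β) p ≡ c2 →
        ¬ InC34 (col p)
  ∉34 p {h} (inj₁ e) c = ≡1⇒∉34 e (subst InC34 (follows-prefix p {h}) c)
  ∉34 p {h} (inj₂ e) c = ≡2⇒∉34 e (subst InC34 (follows-prefix p {h}) c)

  chain : ∀ e → ends e ≡ (zigzag o i 6 , zigzag o i 5) → ChainOf34 C e
  chain e ends≡ = two-vertex-chain C e ends≡
    (subst InC34 (sym (follows-prefix 6)) (≢1,2⇒InC34 α≢1 α≢2))
    (subst InC34 (sym (follows-prefix 5)) (≢1,2⇒InC34 β≢1 β≢2))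
    (λ w a c → inj₂ (34-neighbour-unique 4 5 (inj₂ (∉34 4 (inj₂ refl))) (inj₁ refl)
                                            (inj₂ (∉34 7 (inj₁ refl))) (inj₂ (∉34 8 (inj₂ refl))) w a c))
    (λ w a c → inj₁ (34-neighbour-unique 3 6 (inj₂ (∉34 3 (inj₁ refl))) (inj₂ (∉34 4 (inj₂ refl)))
                                            (inj₁ refl) (inj₂ (∉34 7 (inj₁ refl))) w a c))

-- A good colouring with a 34-chain is canonical

fourth-colour-unique : ∀ x x′ y z → x ≢ c1 → x′ ≢ c1 → y ≢ c1 → z ≢ c1 → y ≢ z →
                       x ≢ y → x ≢ z → x′ ≢ y → x′ ≢ z → x ≡ x′
fourth-colour-unique = toWitness {a? = all? λ x → all? λ x′ → all? λ y → all? λ z →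
  ¬? (x ≟ᶠ c1) →-dec ¬? (x′ ≟ᶠ c1) →-dec ¬? (y ≟ᶠ c1) →-dec ¬? (z ≟ᶠ c1) →-dec ¬? (y ≟ᶠ z) →-dec
  ¬? (x ≟ᶠ y) →-dec ¬? (x ≟ᶠ z) →-dec ¬? (x′ ≟ᶠ y) →-dec ¬? (x′ ≟ᶠ z) →-dec (x ≟ᶠ x′)} _

data Residue3 : ℕ → Set where
  0mod3 : ∀ q → Residue3 (q * 3 + 0)
  1mod3 : ∀ q → Residue3 (q * 3 + 1)
  2mod3 : ∀ q → Residue3 (q * 3 + 2)

residue3 : ∀ s → Residue3 s
residue3 0 = 0mod3 0
residue3 1 = 1mod3 0
residue3 2 = 2mod3 0
residue3 (suc (suc (suc s))) with residue3 s
... | 0mod3 q = 0mod3 (suc q)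
... | 1mod3 q = 1mod3 (suc q)
... | 2mod3 q = 2mod3 (suc q)

cycle3-at-suc : ∀ a b c q r → cycle3 a b c (1 + (q * 3 + r)) ≡ cycle3 a b c (1 + r)
cycle3-at-suc a b c q r =
  trans (cong (cycle3 a b c) (trans (sym (+-assoc 1 (q * 3) r))
      (trans (cong (_+ r) (+-comm 1 (q * 3))) (+-assoc (q * 3) 1 r))))
        (cycle3-periodic a b c q (1 + r))

-- The colours of a good colouring along the zigzag through a 34-chain e₁ = (x, y): the
-- chain and properness force positions 2 3 6 7 to be 2 1 2 1, then |p(A)| = 2 and the
-- nonsingularity of the two 12-edges force 0 1 8 to be α β α, and each later colour is
-- the unique colour other than 1 and its two predecessors; closing up the cycle forces
-- 2n ≡ 2 (mod 3).
module Forcing {m : ℕ} (3<m : 3 < m) (o : Dir) (i : Fin (suc m)) (A : Map (suc m))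
               (normal : NormColouring A) (good : Good A) (chain : ChainOf34 A (zigzagEdge o i 4)) where
  private
    proper = proj₁ normal
    A-pole = proj₂ normal
    L = period {m}

  col : ℕ → Colour
  col p = A (zigzag o i p)

  col≢col₁ : ∀ p → col p ≢ col (1 + p)
  col≢col₁ p = proper _ _ (zigzag-adj₁ o i p)

  col≢col₂ : ∀ p → col p ≢ col (2 + p)
  col≢col₂ p = proper _ _ (zigzag-adj₂ o i p)

  even≢1 : ∀ k → col (twice k) ≢ c1
  even≢1 k e = proper pa _ (pole-adj-zigzag o i k) (trans A-pole (sym e))

  col-periodic : ∀ p → col (L + p) ≡ col p
  col-periodic p = cong A (zigzag-periodic o i p)

  9<L : 9 < L
  9<L = twice-mono-≤ {5} {suc m} (s≤s 3<m)

  <10⇒<L : ∀ {p} → p < 10 → p < L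
  <10⇒<L h = <-≤-trans h 9<L

  zigzag-injective<10 : ∀ {a b} → a < 10 → b < 10 → zigzag o i a ≡ zigzag o i b → a ≡ b
  zigzag-injective<10 a< b< = zigzag-injective o i (<10⇒<L a<) (<10⇒<L b<)

  col4∈34 : InC34 (col 4)
  col4∈34 = subst (λ e → InC34 (A (proj₁ e))) (ends-edge₀ o _) (proj₁ chain)

  col5∈34 : InC34 (col 5)
  col5∈34 = subst (λ e → InC34 (A (proj₂ e))) (ends-edge₀ o _) (proj₁ (proj₂ chain))

  outside-chain : ∀ p → p < 10 → p ≢ 4 → p ≢ 5 → ¬ Path A c3 c4 (zigzag o i 4) (zigzag o i p)
  outside-chain p p<10 p≢4 p≢5 path with subst (λ e → Path A c3 c4 (proj₁ e) (zigzag o i p) →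
                                                     zigzag o i p ≡ proj₁ e ⊎ zigzag o i p ≡ proj₂ e)
                                               (ends-edge₀ o _) (proj₂ (proj₂ chain) _) path
  ... | inj₁ e = p≢4 (zigzag-injective<10 p<10 (<-fromᵇ 4 10) e)
  ... | inj₂ e = p≢5 (zigzag-injective<10 p<10 (<-fromᵇ 5 10) e)

  col2∉34 : ¬ InC34 (col 2)
  col2∉34 c = outside-chain 2 (<-fromᵇ 2 10) (λ ()) (λ ()) (step col4∈34 (sy (zigzag-adj₂ o i 2)) c here)
  col3∉34 : ¬ InC34 (col 3)
  col3∉34 c = outside-chain 3 (<-fromᵇ 3 10) (λ ()) (λ ()) (step col4∈34 (sy (zigzag-adj₁ o i 3)) c here)
  col6∉34 : ¬ InC34 (col 6)
  col6∉34 c = outside-chain 6 (<-fromᵇ 6 10) (λ ()) (λ ()) (step col4∈34 (zigzag-adj₂ o i 4) c here)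
  col7∉34 : ¬ InC34 (col 7)
  col7∉34 c = outside-chain 7 (<-fromᵇ 7 10) (λ ()) (λ ())
                (step col4∈34 (zigzag-adj₁ o i 4) col5∈34 (step col5∈34 (zigzag-adj₂ o i 5) c here))

  ∉34⇒≡2 : ∀ {x} → ¬ InC34 x → x ≢ c1 → x ≡ c2
  ∉34⇒≡2 {x} x∉34 x≢1 with x ≟ᶠ c2
  ... | yes x≡2 = x≡2
  ... | no x≢2 = ⊥-elim (x∉34 (≢1,2⇒InC34 x≢1 x≢2))

  ∉34⇒≡1 : ∀ {x} → ¬ InC34 x → x ≢ c2 → x ≡ c1
  ∉34⇒≡1 {x} x∉34 x≢2 with x ≟ᶠ c1
  ... | yes x≡1 = x≡1
  ... | no x≢1 = ⊥-elim (x∉34 (≢1,2⇒InC34 x≢1 x≢2))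

  col2≡2 : col 2 ≡ c2
  col2≡2 = ∉34⇒≡2 col2∉34 (even≢1 1)
  col3≡1 : col 3 ≡ c1
  col3≡1 = ∉34⇒≡1 col3∉34 (λ e → col≢col₁ 2 (trans col2≡2 (sym e)))
  col6≡2 : col 6 ≡ c2
  col6≡2 = ∉34⇒≡2 col6∉34 (even≢1 3)
  col7≡1 : col 7 ≡ c1
  col7≡1 = ∉34⇒≡1 col7∉34 (λ e → col≢col₁ 6 (trans col6≡2 (sym e)))

  other-positions≢1 : ∀ p → p < L → p ≢ 3 → p ≢ 7 → col p ≢ c1
  other-positions≢1 p p<L p≢3 p≢7 with parity p
  ... | even k = even≢1 k
  ... | odd k = λ e → at (count≡2-exhaustive (λ j → A (yb j) ≟ᶠ c1) (proj₁ good)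
                           (∈-allFin y₃) (∈-allFin y₇) y₃≢y₇ (y-colour 1 col3≡1) (y-colour 3 col7≡1)
                           (∈-allFin (yIndex o (move^ o k i))) (y-colour k e))
    where
    y₃ = yIndex o (move^ o 1 i)
    y₇ = yIndex o (move^ o 3 i)
    y-colour : ∀ k → col (suc (twice k)) ≡ c1 → A (yb (yIndex o (move^ o k i))) ≡ c1
    y-colour k e = trans (cong A (sym (zigzag-odd o i k))) e
    y₃≢y₇ : y₃ ≢ y₇
    y₃≢y₇ e with zigzag-injective<10 {3} {7} (<-fromᵇ 3 10) (<-fromᵇ 7 10)
                   (trans (zigzag-odd o i 1) (trans (cong yb e) (sym (zigzag-odd o i 3))))
    ... | ()
    same-y : ∀ q → yIndex o (move^ o k i) ≡ yIndex o (move^ o q i) →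
             zigzag o i (suc (twice k)) ≡ zigzag o i (suc (twice q))
    same-y q e = trans (zigzag-odd o i k) (trans (cong yb e) (sym (zigzag-odd o i q)))
    at : yIndex o (move^ o k i) ≡ y₃ ⊎ yIndex o (move^ o k i) ≡ y₇ → ⊥
    at (inj₁ e) = p≢3 (zigzag-injective o i p<L (<10⇒<L (<-fromᵇ 3 10)) (same-y 1 e))
    at (inj₂ e) = p≢7 (zigzag-injective o i p<L (<10⇒<L (<-fromᵇ 7 10)) (same-y 3 e))

  α β : Colour
  α = col 4
  β = col 5

  colours34 : Colours34 α β
  colours34 = record { α≢β = col≢col₁ 4 ; α≢1 = ∈34≢1 col4∈34 ; α≢2 = ∈34≢2 col4∈34
                     ; β≢1 = ∈34≢1 col5∈34 ; β≢2 = ∈34≢2 col5∈34 }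
    where
    ∈34≢1 : ∀ {x} → InC34 x → x ≢ c1
    ∈34≢1 (inj₁ refl) ()
    ∈34≢1 (inj₂ refl) ()
    ∈34≢2 : ∀ {x} → InC34 x → x ≢ c2
    ∈34≢2 (inj₁ refl) ()
    ∈34≢2 (inj₂ refl) ()
  open Colours34 colours34

  12-edge-faces-differ : ∀ k → col (twice (suc k)) ≡ c2 → col (suc (twice (suc k))) ≡ c1 →
                         col (suc (twice k)) ≢ col (twice (suc (suc k)))
  12-edge-faces-differ k c₂ c₁ = Nonsingular-Joins {C = A} (faces-zigzagEdge o i (suc (twice k)))
    (proj₂ (proj₂ good) (zigzagEdge o i (twice (suc k)))
      (Joins-InC12 {C = A} (ends-zigzagEdge o i (twice (suc k))) (inj₂ c₂) (inj₁ c₁)))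

  col1≢col4 : col 1 ≢ col 4
  col1≢col4 = 12-edge-faces-differ 0 col2≡2 col3≡1

  col5≢col8 : col 5 ≢ col 8
  col5≢col8 = 12-edge-faces-differ 2 col6≡2 col7≡1

  col1≡β : col 1 ≡ β
  col1≡β = fourth-colour-unique _ _ c2 α (other-positions≢1 1 (<10⇒<L (<-fromᵇ 1 10)) (λ ()) (λ ())) β≢1
             (λ ()) α≢1 (≢-sym α≢2) (λ e → col≢col₁ 1 (trans e (sym col2≡2))) col1≢col4
             (λ e → β≢2 e) (≢-sym α≢β)

  col8≡α : col 8 ≡ α
  col8≡α = fourth-colour-unique _ _ c2 β (even≢1 4) α≢1 (λ ()) β≢1 (≢-sym β≢2)
             (λ e → col≢col₂ 6 (trans col6≡2 (sym e))) (λ e → col5≢col8 (sym e)) α≢2 α≢β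

  col0≡α : col 0 ≡ α
  col0≡α = fourth-colour-unique _ _ c2 β (even≢1 0) α≢1 (λ ()) β≢1 (≢-sym β≢2)
             (λ e → col≢col₂ 0 (trans e (sym col2≡2))) (λ e → col≢col₁ 0 (trans e (sym col1≡β))) α≢2 α≢β

  col9≡β⊎2 : col 9 ≡ β ⊎ col 9 ≡ c2
  col9≡β⊎2 with col 9 ≟ᶠ c2
  ... | yes e = inj₂ e
  ... | no col9≢2 = inj₁ (fourth-colour-unique _ _ c2 α (other-positions≢1 9 (<10⇒<L (<-fromᵇ 9 10)) (λ ()) (λ ()))
                            β≢1 (λ ()) α≢1 (≢-sym α≢2) col9≢2 (λ e → col≢col₁ 8 (trans col8≡α (sym e)))
                            β≢2 (≢-sym α≢β))

  module Propagate (u v w : Colour) (col8≡u : col 8 ≡ u) (col9≡v : col 9 ≡ v)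
                   (u≢v : u ≢ v) (v≢w : v ≢ w) (w≢u : w ≢ u) (u≢1 : u ≢ c1) (v≢1 : v ≢ c1) (w≢1 : w ≢ c1) where

    cycle3-fresh : ∀ t → cycle3 u v w (2 + t) ≢ c1 × cycle3 u v w (2 + t) ≢ cycle3 u v w t ×
                         cycle3 u v w (2 + t) ≢ cycle3 u v w (1 + t)
    cycle3-fresh 0 = w≢1 , w≢u , ≢-sym v≢w
    cycle3-fresh 1 = u≢1 , u≢v , ≢-sym w≢u
    cycle3-fresh 2 = v≢1 , v≢w , ≢-sym u≢v
    cycle3-fresh (suc (suc (suc t))) = cycle3-fresh t

    propagate : ∀ t → 9 + t < L → col (8 + t) ≡ cycle3 u v w t × col (9 + t) ≡ cycle3 u v w (1 + t)
    propagate 0 _ = col8≡u , col9≡v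
    propagate (suc t) h with propagate t (<-trans (n<1+n _) h)
    ... | e₈ , e₉ = e₉ , fourth-colour-unique _ _ (col (8 + t)) (col (9 + t))
          (other-positions≢1 (10 + t) h (λ ()) (λ ())) fresh≢1
          (other-positions≢1 (8 + t) (<-trans (n<1+n _) (<-trans (n<1+n _) h)) (λ ()) (λ ()))
          (other-positions≢1 (9 + t) (<-trans (n<1+n _) h) (λ ()) (λ ()))
          (col≢col₁ (8 + t)) (λ e → col≢col₂ (8 + t) (sym e)) (λ e → col≢col₁ (9 + t) (sym e))
          (λ e → fresh≢t (trans e e₈)) (λ e → fresh≢t+1 (trans e e₉))
      where
      fresh≢1 = proj₁ (cycle3-fresh t)
      fresh≢t = proj₁ (proj₂ (cycle3-fresh t))
      fresh≢t+1 = proj₂ (proj₂ (cycle3-fresh t))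

  private
    s = L ∸ 10

    L≡10+s : L ≡ 10 + s
    L≡10+s = sym (m+[n∸m]≡n 9<L)

    9+s<L : 9 + s < L
    9+s<L = subst (9 + s <_) (sym L≡10+s) ≤-refl

    col-10+s : col (10 + s) ≡ α
    col-10+s = trans (cong col (sym L≡10+s)) (trans (cong col (sym (+-identityʳ L))) (trans (col-periodic 0) col0≡α))

    col-11+s : col (11 + s) ≡ β
    col-11+s = trans (cong (λ z → col (suc z)) (sym L≡10+s))
                     (trans (cong col (+-comm 1 L)) (trans (col-periodic 1) col1≡β))

    col-8+s≢α : col (8 + s) ≢ α
    col-8+s≢α e = col≢col₂ (8 + s) (trans e (sym col-10+s))

    col-9+s≢α : col (9 + s) ≢ α
    col-9+s≢α e = col≢col₁ (9 + s) (trans e (sym col-10+s))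

    col-9+s≢β : col (9 + s) ≢ β
    col-9+s≢β e = col≢col₂ (9 + s) (trans e (sym col-11+s))

  period-shape : col 9 ≡ β × Σ[ R ∈ ℕ ] L ≡ 14 + R * 3
  period-shape with col9≡β⊎2
  ... | inj₁ col9≡β = col9≡β , closing (residue3 s) refl
    where
    open Propagate α β c2 col8≡α col9≡β α≢β β≢2 (≢-sym α≢2) α≢1 β≢1 (λ ())
    closing : ∀ {s′} → Residue3 s′ → s′ ≡ s → Σ[ R ∈ ℕ ] L ≡ 14 + R * 3
    closing (0mod3 q) e = ⊥-elim (col-8+s≢α (trans (proj₁ (propagate s 9+s<L))
      (trans (cong (cycle3 α β c2) (sym e)) (cycle3-periodic α β c2 q 0))))
    closing (1mod3 zero) e with () ← twice≢suc-twice (suc m) 5 (trans L≡10+s (cong (10 +_) (sym e)))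
    closing (1mod3 (suc R)) e = R , trans L≡10+s (trans (cong (10 +_) (sym e)) (cong (13 +_) (+-comm (R * 3) 1)))
    closing (2mod3 q) e = ⊥-elim (col-9+s≢α (trans (proj₂ (propagate s 9+s<L))
      (trans (cong (λ z → cycle3 α β c2 (1 + z)) (sym e)) (cycle3-at-suc α β c2 q 2))))
  ... | inj₂ col9≡2 = ⊥-elim (closing (residue3 s) refl)
    where
    open Propagate α c2 β col8≡α col9≡2 α≢2 (≢-sym β≢2) (≢-sym α≢β) α≢1 (λ ()) β≢1
    closing : ∀ {s′} → Residue3 s′ → s′ ≡ s → ⊥
    closing (0mod3 q) e = col-8+s≢α (trans (proj₁ (propagate s 9+s<L))
      (trans (cong (cycle3 α c2 β) (sym e)) (cycle3-periodic α c2 β q 0)))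
    closing (1mod3 q) e = col-9+s≢β (trans (proj₂ (propagate s 9+s<L))
      (trans (cong (λ z → cycle3 α c2 β (1 + z)) (sym e)) (cycle3-at-suc α c2 β q 1)))
    closing (2mod3 q) e = col-9+s≢α (trans (proj₂ (propagate s 9+s<L))
      (trans (cong (λ z → cycle3 α c2 β (1 + z)) (sym e)) (cycle3-at-suc α c2 β q 2)))

  R : ℕ
  R = proj₁ (proj₂ period-shape)

  period≡ : L ≡ 14 + R * 3
  period≡ = proj₂ (proj₂ period-shape)

  follows-canonical : ∀ p → p < L → col p ≡ patternAt (canonical α β) p
  follows-canonical 0 _ = col0≡α
  follows-canonical 1 _ = col1≡β
  follows-canonical 2 _ = col2≡2
  follows-canonical 3 _ = col3≡1
  follows-canonical 4 _ = refl
  follows-canonical 5 _ = refl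
  follows-canonical 6 _ = col6≡2
  follows-canonical 7 _ = col7≡1
  follows-canonical 8 _ = col8≡α
  follows-canonical (suc (suc (suc (suc (suc (suc (suc (suc (suc t))))))))) h = proj₂ (propagate t h)
    where open Propagate α β c2 col8≡α (proj₁ period-shape) α≢β β≢2 (≢-sym α≢2) α≢1 β≢1 (λ ())

-- Kempe changes

swap-left : ∀ i j → swap i j i ≡ j
swap-left i j with i ≟ᶠ i
... | yes _ = refl
... | no i≢i = ⊥-elim (i≢i refl)

swap-right : ∀ i j → i ≢ j → swap i j j ≡ i
swap-right i j i≢j with j ≟ᶠ i
... | yes j≡i = ⊥-elim (i≢j (sym j≡i))
... | no _ with j ≟ᶠ j
... | yes _ = refl
... | no j≢j = ⊥-elim (j≢j refl)

swap-other : ∀ i j c → c ≢ i → c ≢ j → swap i j c ≡ c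
swap-other i j c c≢i c≢j with c ≟ᶠ i
... | yes c≡i = ⊥-elim (c≢i c≡i)
... | no _ with c ≟ᶠ j
... | yes c≡j = ⊥-elim (c≢j c≡j)
... | no _ = refl

swap-involutive : ∀ i j c → i ≢ j → swap i j (swap i j c) ≡ c
swap-involutive i j c i≢j with c ≟ᶠ i
... | yes refl = swap-right c j i≢j
... | no c≢i with c ≟ᶠ j
... | yes refl = swap-left i c
... | no c≢j = swap-other i j c c≢i c≢j

InC? : ∀ x y c → Dec (InC x y c)
InC? x y c = (c ≟ᶠ x) ⊎-dec (c ≟ᶠ y)

∉InC : ∀ {x y c} → c ≢ x → c ≢ y → ¬ InC x y c
∉InC c≢x _ (inj₁ c≡x) = c≢x c≡x
∉InC _ c≢y (inj₂ c≡y) = c≢y c≡y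

swap-permutation : ∀ i j → i ≢ j → Permutation′ 4
swap-permutation i j i≢j =
  permutation (swap i j) (swap i j) (λ c → swap-involutive i j c i≢j) (λ c → swap-involutive i j c i≢j)

module _ {n : ℕ} {C : Map n} {x y : Colour} where

  Path-++ : ∀ {u v w : V n} → Path C x y u v → Path C x y v w → Path C x y u w
  Path-++ here q = q
  Path-++ (step cu a cv p) q = step cu a cv (Path-++ p q)

  Path-reverse : ∀ {u w : V n} → InC x y (C u) → Path C x y u w → Path C x y w u
  Path-reverse {u} cu p = go p here
    where
    go : ∀ {a b} → Path C x y a b → Path C x y a u → Path C x y b u
    go here acc = acc
    go (step ca adj cb p) acc = go p (step cb (sy adj) ca acc)

module KempeChange {n : ℕ} (C : Map n) (x y : Colour) (x≢y : x ≢ y)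
                   (S : V n → Set) (S? : ∀ v → Dec (S v)) (v₀ : V n) (v₀∈S : S v₀)
                   (S⊆xy : ∀ w → S w → InC x y (C w))
                   (S-closed : ∀ u w → S u → Adj u w → InC x y (C w) → S w)
                   (S-connected : ∀ w → S w → Path C x y v₀ w) where

  swapped : Map n
  swapped w with S? w
  ... | yes _ = swap x y (C w)
  ... | no _ = C w

  swapped-in : ∀ w → S w → swapped w ≡ swap x y (C w)
  swapped-in w w∈S with S? w
  ... | yes _ = refl
  ... | no w∉S = ⊥-elim (w∉S w∈S)

  swapped-out : ∀ w → ¬ S w → swapped w ≡ C w
  swapped-out w w∉S with S? w
  ... | yes w∈S = ⊥-elim (w∉S w∈S)
  ... | no _ = refl

  reach : ∀ {u w} → S u → Path C x y u w → S w
  reach u∈S here = u∈S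
  reach u∈S (step _ a cw p) = reach (S-closed _ _ u∈S a cw) p

  kempe : Kempe C swapped x y v₀
  kempe = x≢y , S⊆xy v₀ v₀∈S , (λ w p → swapped-in w (reach v₀∈S p)) ,
          (λ w no-path → swapped-out w (λ w∈S → no-path (S-connected w w∈S)))

  proper-chain : ∀ w → InC x y (C w) → ¬ S w → ProperChain C x y v₀
  proper-chain w cw w∉S = w , cw , (λ p → w∉S (reach v₀∈S p))

  improper-chain : (∀ w → InC x y (C w) → S w) → ¬ ProperChain C x y v₀
  improper-chain all (w , cw , no-path) = no-path (S-connected w (all w cw))

module ZigzagWalk {m : ℕ} (o : Dir) (i : Fin (suc m)) (C : Map (suc m)) (x y : Colour) (lo hi : ℕ)
                  (hi∈ : InC x y (C (zigzag o i hi)))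
                  (step-up : ∀ p → lo ≤ p → p < hi → InC x y (C (zigzag o i p)) →
                             InC x y (C (zigzag o i (suc p))) ⊎ (InC x y (C (zigzag o i (2 + p))) × 2 + p ≤ hi)) where

  walk : ∀ d p → d + p ≡ hi → lo ≤ p → InC x y (C (zigzag o i p)) → Path C x y (zigzag o i p) (zigzag o i hi)
  walk zero p refl _ _ = here
  walk (suc zero) p refl lo≤p cp = [ (λ c₁ → step cp (zigzag-adj₁ o i p) c₁ here) ,
                                     (λ (_ , 2+p≤1+p) → ⊥-elim (1+n≰n 2+p≤1+p)) ]′
                                   (step-up p lo≤p ≤-refl cp)
  walk (suc (suc d)) p refl lo≤p cp =
    [ (λ c₁ → step cp (zigzag-adj₁ o i p) c₁ (walk (suc d) (suc p) (+-suc (suc d) p) (m≤n⇒m≤1+n lo≤p) c₁)) ,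
      (λ (c₂ , _) → step cp (zigzag-adj₂ o i p) c₂
                      (walk d (2 + p) (trans (+-suc d (suc p)) (cong suc (+-suc d p))) (m≤n⇒m≤1+n (m≤n⇒m≤1+n lo≤p))
                          c₂)) ]′
    (step-up p lo≤p (s≤s (m≤n⇒m≤1+n (m≤n+m p d))) cp)

  walk-up : ∀ p → lo ≤ p → p ≤ hi → InC x y (C (zigzag o i p)) → Path C x y (zigzag o i p) (zigzag o i hi)
  walk-up p lo≤p p≤hi cp = walk (hi ∸ p) p (m∸n+n≡m p≤hi) lo≤p cp

-- Part (c)

ends-adjacent : ∀ {n} (e : TE n) → Adj (proj₁ (ends e)) (proj₂ (ends e))
ends-adjacent (te0 j) = xy0 j
ends-adjacent (te1 j) = xy1 j

x-end : ∀ {n} (e : TE n) → Σ (Fin n) λ c → proj₁ (ends e) ≡ xa c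
x-end (te0 j) = j , refl
x-end (te1 j) = j , refl

module ExchangeAlpha2 {m : ℕ} (o : Dir) (i : Fin (suc m)) {α β : Colour} (αβ : Colours34 α β)
                      (R : ℕ) (period≡ : period {m} ≡ 14 + R * 3)
                      (A : Map (suc m)) (A-pole : A pa ≡ c1)
                      (follows : ∀ p → p < period {m} → A (zigzag o i p) ≡ patternAt (canonical α β) p) where
  open Colours34 αβ

  B : Map (suc m)
  B v = swap α c2 (A v)

  swap-cycle3 : ∀ t → swap α c2 (cycle3 α β c2 t) ≡ cycle3 c2 β α t
  swap-cycle3 0 = swap-left α c2
  swap-cycle3 1 = swap-other α c2 β (≢-sym α≢β) β≢2
  swap-cycle3 2 = swap-right α c2 α≢2
  swap-cycle3 (suc (suc (suc t))) = swap-cycle3 t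

  swap-canonical : ∀ p → swap α c2 (patternAt (canonical α β) p) ≡ patternAt (canonical-α↔2 α β) p
  swap-canonical 0 = swap-left α c2
  swap-canonical 1 = swap-other α c2 β (≢-sym α≢β) β≢2
  swap-canonical 2 = swap-right α c2 α≢2
  swap-canonical 3 = swap-other α c2 c1 (≢-sym α≢1) (λ ())
  swap-canonical 4 = swap-left α c2
  swap-canonical 5 = swap-other α c2 β (≢-sym α≢β) β≢2
  swap-canonical 6 = swap-right α c2 α≢2
  swap-canonical 7 = swap-other α c2 c1 (≢-sym α≢1) (λ ())
  swap-canonical (suc (suc (suc (suc (suc (suc (suc (suc t)))))))) = swap-cycle3 t

  B-pole : B pa ≡ c1
  B-pole = trans (cong (swap α c2) A-pole) (swap-other α c2 c1 (≢-sym α≢1) (λ ()))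

  B-follows : ∀ p → p < period {m} → B (zigzag o i p) ≡ patternAt (canonical-α↔2 α β) p
  B-follows p h = trans (cong (swap α c2) (follows p h)) (swap-canonical p)

  A≈B : EqualCol A B
  A≈B = swap-permutation α c2 α≢2 , λ v → sym (swap-involutive α c2 (A v) α≢2)

  module CA = CanonicalColouring o i αβ R period≡ A A-pole follows
  module CB = SwappedColouring o i αβ R period≡ B B-pole B-follows

  -- The x-end of an edge through the y-vertex at position 5 is at position 4 or 6.
  part-c : ∀ (e₂ : TE (suc m)) → proj₂ (ends e₂) ≡ zigzag o i 5 →
           Σ (Map (suc m)) λ B′ → NormColouring B′ × EqualCol A B′ × Good B′ × ChainOf34 B′ e₂
  part-c e₂ y≡ with x-end e₂ | zigzag-neighbour o i 3 (subst (λ z → Adj z (proj₁ (ends e₂))) y≡ (sy (ends-adjacent e₂)))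
  ... | c , x≡ | via-pole e _ with () ← trans (sym x≡) e
  ... | c , x≡ | before₂ e with () ← trans (sym x≡) e
  ... | c , x≡ | after₂ e with () ← trans (sym x≡) e
  ... | _ , _ | before₁ e = A , CA.normColouring , (Permutation.id , λ _ → refl) , CA.good ,
                            CA.chain e₂ (cong₂ _,_ e y≡)
  ... | _ , _ | after₁ e = B , CB.normColouring , A≈B , CB.good , CB.chain e₂ (cong₂ _,_ e y≡)

-- Part (d)

next-block≤ : ∀ q R r → q * 3 + r < R * 3 → suc q * 3 ≤ R * 3
next-block≤ zero zero r ()
next-block≤ zero (suc R) r _ = s≤s (s≤s (s≤s z≤n))
next-block≤ (suc q) zero r ()
next-block≤ (suc q) (suc R) r (s≤s (s≤s (s≤s l))) = s≤s (s≤s (s≤s (next-block≤ q R r l)))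

record Pattern11 : Set where
  constructor mkPattern11
  field u0 u1 u2 u3 u4 u5 u6 u7 u8 u9 u10 a b c : Colour

pattern 10+_ k = suc (suc (suc (suc (suc (suc (suc (suc (suc (suc k)))))))))
pattern 11+_ k = suc (10+ k)

pattern11At : Pattern11 → ℕ → Colour
pattern11At W 0 = Pattern11.u0 W
pattern11At W 1 = Pattern11.u1 W
pattern11At W 2 = Pattern11.u2 W
pattern11At W 3 = Pattern11.u3 W
pattern11At W 4 = Pattern11.u4 W
pattern11At W 5 = Pattern11.u5 W
pattern11At W 6 = Pattern11.u6 W
pattern11At W 7 = Pattern11.u7 W
pattern11At W 8 = Pattern11.u8 W
pattern11At W 9 = Pattern11.u9 W
pattern11At W 10 = Pattern11.u10 W
pattern11At W (11+ k) = cycle3 (Pattern11.a W) (Pattern11.b W) (Pattern11.c W) k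

module FollowsPattern11 {m : ℕ} (o : Dir) (i : Fin (suc m)) (C : Map (suc m)) (W : Pattern11) (R : ℕ)
                        (period≡ : period {m} ≡ 14 + R * 3)
                        (follows : ∀ p → p < period {m} → C (zigzag o i p) ≡ pattern11At W p) where
  open Pattern11 W
  private
    L = period {m}

  col : ℕ → Colour
  col p = C (zigzag o i p)

  prefix : ∀ p → {T (p <ᵇ 14)} → col p ≡ pattern11At W p
  prefix p {h} = follows p (subst (p <_) (sym period≡) (≤-trans (<-fromᵇ p 14 {h}) (m≤m+n 14 (R * 3))))

  block : ℕ → ℕ → ℕ
  block q r = 11 + (q * 3 + r)

  col-block : ∀ q r → block q r < L → col (block q r) ≡ cycle3 a b c r
  col-block q r l = trans (follows _ l) (cycle3-periodic a b c q r)

  +-block : ∀ k q r → k + block q r ≡ block q (k + r)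
  +-block k q r = begin
    k + (11 + (q * 3 + r))     ≡⟨ +-assoc k 11 (q * 3 + r) ⟨
    k + 11 + (q * 3 + r)       ≡⟨ cong (_+ (q * 3 + r)) (+-comm k 11) ⟩
    11 + k + (q * 3 + r)       ≡⟨ +-assoc 11 k (q * 3 + r) ⟩
    11 + (k + (q * 3 + r))     ≡⟨ cong (11 +_) (+-assoc k (q * 3) r) ⟨
    11 + (k + q * 3 + r)       ≡⟨ cong (λ z → 11 + (z + r)) (+-comm k (q * 3)) ⟩
    11 + (q * 3 + k + r)       ≡⟨ cong (11 +_) (+-assoc (q * 3) k r) ⟩
    11 + (q * 3 + (k + r))     ∎
    where open ≡-Reasoning

  block-3 : ∀ q x → block q (3 + x) ≡ block (suc q) x
  block-3 q x = cong (11 +_) (trans (sym (+-assoc (q * 3) 3 x)) (cong (_+ x) (+-comm (q * 3) 3)))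

  block-end≤L : ∀ q r → r < 3 → block q r < L → block q 3 ≤ L
  block-end≤L q r r<3 l = subst (_≤ L) (cong (11 +_) (+-comm 3 (q * 3)))
    (subst (14 + q * 3 ≤_) (sym period≡) (+-monoʳ-≤ 11 (next-block≤ q (suc R) r l′)))
    where
    l′ : q * 3 + r < suc R * 3
    l′ = +-cancelˡ-< 11 _ _ (subst (block q r <_) period≡ l)

  col-L : col L ≡ u0
  col-L = trans (cong col (sym (+-identityʳ L)))
                (trans (cong C (zigzag-periodic o i 0)) (follows 0 (subst (0 <_) (sym period≡) (s≤s z≤n))))

  last-block<L : ∀ x → x < 3 → block R x < L
  last-block<L x h = subst (block R x <_) (sym period≡)
    (+-monoʳ-< 11 (subst (R * 3 + x <_) (+-comm (R * 3) 3) (+-monoʳ-< (R * 3) h)))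

  twice-m≡ : twice m ≡ 12 + R * 3
  twice-m≡ = suc-injective (suc-injective period≡)

  col-last : col (twice m + 1) ≡ c
  col-last = trans (cong col (trans (cong (_+ 1) twice-m≡) (cong (11 +_) (sym (+-suc (R * 3) 1)))))
                   (col-block R 2 (last-block<L 2 (<-fromᵇ 2 3)))

  col-second-last : col (twice m) ≡ b
  col-second-last = trans (cong col (trans twice-m≡ (cong (11 +_) (+-comm 1 (R * 3)))))
                          (col-block R 1 (last-block<L 1 (<-fromᵇ 1 3)))

  col-in-block : ∀ q r k → k + r < 3 → block q r < L → col (k + block q r) ≡ cycle3 a b c (k + r)
  col-in-block q r k k+r<3 l = trans (cong col (+-block k q r))
    (col-block q (k + r) (<-≤-trans (+-monoʳ-< 11 (+-monoʳ-< (q * 3) k+r<3))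
        (block-end≤L q r (≤-<-trans (m≤n+m r k) k+r<3) l)))

  col-next-block : ∀ q x → x < 3 → block q x < L → u0 ≡ a → col (block q 3) ≡ a
  col-next-block q x x<3 l u0≡a with m≤n⇒m<n∨m≡n (block-end≤L q x x<3 l)
  ... | inj₁ lt = trans (cong col (block-3 q 0)) (col-block (suc q) 0 (subst (_< L) (block-3 q 0) lt))
  ... | inj₂ eq = trans (cong col eq) (trans col-L u0≡a)

  col-after-block : ∀ q r k → 3 ≡ k + r → r < 3 → block q r < L → u0 ≡ a → col (k + block q r) ≡ a
  col-after-block q r k 3≡k+r r<3 l u0≡a =
    trans (cong col (trans (+-block k q r) (cong (block q) (sym 3≡k+r)))) (col-next-block q r r<3 l u0≡a)

  block+2≤L : ∀ q r → r < 2 → block q r < L → 2 + block q r ≤ L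
  block+2≤L q r r<2 l = subst (_≤ L) (sym (+-block 2 q r))
    (≤-trans (+-monoʳ-≤ 11 (+-monoʳ-≤ (q * 3) (s≤s (s≤s (≤-pred r<2)))))
        (block-end≤L q r (<-trans r<2 (<-fromᵇ 2 3)) l))

module ZigzagNeighbourhood {m : ℕ} (o : Dir) (i : Fin (suc m)) where

  neighbours-satisfy : ∀ (P : V (suc m) → Set) q → (Even q → P pa) →
                       P (zigzag o i q) → P (zigzag o i (1 + q)) → P (zigzag o i (3 + q)) → P (zigzag o i (4 + q)) →
                       ∀ w → Adj (zigzag o i (2 + q)) w → P w
  neighbours-satisfy P q P-pole P₀ P₁ P₃ P₄ w a with zigzag-neighbour o i q a
  ... | via-pole refl q-even = P-pole q-even
  ... | before₂ refl = P₀
  ... | before₁ refl = P₁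
  ... | after₁ refl = P₃
  ... | after₂ refl = P₄

  -- Position 1 is position period + 1, whose zigzag neighbours are period - 1, 0, 2, 3.
  neighbours-of-1-satisfy : ∀ (P : V (suc m) → Set) → P (zigzag o i (twice m + 1)) →
                            P (zigzag o i 0) → P (zigzag o i 2) → P (zigzag o i 3) →
                            ∀ w → Adj (zigzag o i 1) w → P w
  neighbours-of-1-satisfy P P₋₁ P₀ P₂ P₃ w a =
    neighbours-satisfy P (twice m + 1)
      (λ (k , e) → ⊥-elim (twice≢suc-twice k m (trans (sym e) (+-comm (twice m) 1))))
      P₋₁ (subst P (sym (wrap 1 0 refl)) P₀) (subst P (sym (wrap 3 2 refl)) P₂) (subst P (sym (wrap 4 3 refl)) P₃)
      w (subst (λ z → Adj z w) (sym (zigzag-periodic o i 1)) a)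
    where
    wrap : ∀ k x → k + 1 ≡ 2 + x → zigzag o i (k + (twice m + 1)) ≡ zigzag o i x
    wrap k x eq = trans (cong (zigzag o i) (begin
      k + (twice m + 1)    ≡⟨ +-assoc k (twice m) 1 ⟨
      k + twice m + 1      ≡⟨ cong (_+ 1) (+-comm k (twice m)) ⟩
      twice m + k + 1      ≡⟨ +-assoc (twice m) k 1 ⟩
      twice m + (k + 1)    ≡⟨ cong (twice m +_) eq ⟩
      twice m + (2 + x)    ≡⟨ +-suc (twice m) (suc x) ⟩
      suc (twice m + suc x) ≡⟨ cong suc (+-suc (twice m) x) ⟩
      period {m} + x       ∎)) (zigzag-periodic o i x)
      where open ≡-Reasoning

-- The colours along the zigzag before and after each Kempe change of part (d) (block | tail):
--   A   α β 2 1 α β 2 1 α β 2 | α β 2    (canonical α β)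
--   A₁  2 β α 1 2 β α 1 2 β α | 2 β α    A(α,2) is connected, so this change is improper
--   A₂  2 1 α β 2 1 α β 2 1 α | 2 β α    the (1,β)-chain at positions 1 3 5 7 9
-- Forward, towards the edge at positions 6 7:
--   A₃  β 1 α β 2 1 α β 2 1 α | β 2 α    the (2,β)-chain through 0: all but positions 3 4 7 8
--   B   β 2 α β 2 1 α β 2 1 α | β 2 α    the (1,2)-chain {1}; canonical from position 2 on
-- Backward, towards the edge at positions 2 3:
--   A₃  2 1 α β 2 1 α β 2 1 β | 2 α β    the (α,β)-chain through 10: all but positions 2 3 6 7
--   B   2 1 α β 2 1 α β 2 α β | 2 α β    the (1,α)-chain {9}; canonical from position -2 on
module ParallelMoves {m : ℕ} (o : Dir) (i : Fin (suc m)) {α β : Colour} (αβ : Colours34 α β)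
                     (R : ℕ) (period≡ : period {m} ≡ 14 + R * 3)
                     (A : Map (suc m)) (A-pole : A pa ≡ c1)
                     (follows : ∀ p → p < period {m} → A (zigzag o i p) ≡ patternAt (canonical α β) p) where
  open Colours34 αβ
  open ZigzagNeighbourhood o i

  <14⇒<L : ∀ {p} → p < 14 → p < period {m}
  <14⇒<L {p} h = subst (p <_) (sym period≡) (≤-trans h (m≤m+n 14 (R * 3)))

  position<L : ∀ p → {T (p <ᵇ 14)} → p < period {m}
  position<L p {h} = <14⇒<L (<-fromᵇ p 14 {h})

  same-position : ∀ {p} q → {T (q <ᵇ 14)} → p < period {m} → zigzag o i p ≡ zigzag o i q → p ≡ q
  same-position q {h} p< = zigzag-injective o i p< (position<L q {h})

  wordA : Pattern11
  wordA = mkPattern11 α β c2 c1 α β c2 c1 α β c2 α β c2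

  A-follows : ∀ p → p < period {m} → A (zigzag o i p) ≡ pattern11At wordA p
  A-follows 0 h = follows 0 h
  A-follows 1 h = follows 1 h
  A-follows 2 h = follows 2 h
  A-follows 3 h = follows 3 h
  A-follows 4 h = follows 4 h
  A-follows 5 h = follows 5 h
  A-follows 6 h = follows 6 h
  A-follows 7 h = follows 7 h
  A-follows 8 h = follows 8 h
  A-follows 9 h = follows 9 h
  A-follows 10 h = follows 10 h
  A-follows (11+ k) h = follows _ h

  module PA = FollowsPattern11 o i A wordA R period≡ A-follows

  walk-α2 : ∀ p → 0 ≤ p → p < period {m} → InC α c2 (A (zigzag o i p)) →
         InC α c2 (A (zigzag o i (suc p))) ⊎ (InC α c2 (A (zigzag o i (2 + p))) × 2 + p ≤ period {m})
  walk-α2 0 _ h c = inj₂ (inj₂ (PA.prefix 2) , position<L 1)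
  walk-α2 1 _ h c = ⊥-elim (∉InC (≢-sym α≢β) β≢2 (subst (InC α c2) (A-follows 1 h) c))
  walk-α2 2 _ h c = inj₂ (inj₁ (PA.prefix 4) , position<L 3)
  walk-α2 3 _ h c = ⊥-elim (∉InC (≢-sym α≢1) (λ ()) (subst (InC α c2) (A-follows 3 h) c))
  walk-α2 4 _ h c = inj₂ (inj₂ (PA.prefix 6) , position<L 5)
  walk-α2 5 _ h c = ⊥-elim (∉InC (≢-sym α≢β) β≢2 (subst (InC α c2) (A-follows 5 h) c))
  walk-α2 6 _ h c = inj₂ (inj₁ (PA.prefix 8) , position<L 7)
  walk-α2 7 _ h c = ⊥-elim (∉InC (≢-sym α≢1) (λ ()) (subst (InC α c2) (A-follows 7 h) c))
  walk-α2 8 _ h c = inj₂ (inj₂ (PA.prefix 10) , position<L 9)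
  walk-α2 9 _ h c = ⊥-elim (∉InC (≢-sym α≢β) β≢2 (subst (InC α c2) (A-follows 9 h) c))
  walk-α2 10 _ h c = inj₁ (inj₁ (PA.prefix 11))
  walk-α2 (11+ k) _ h c with residue3 k
  ... | 0mod3 q = inj₂ (inj₂ (trans (PA.col-in-block q 0 2 (<-fromᵇ 2 3) h) refl) , PA.block+2≤L q 0 (<-fromᵇ 0 2) h)
  ... | 1mod3 q = ⊥-elim (∉InC (≢-sym α≢β) β≢2 (subst (InC α c2) (PA.col-block q 1 h) c))
  ... | 2mod3 q = inj₁ (inj₁ (PA.col-after-block q 2 1 refl (<-fromᵇ 2 3) h refl))

  zigzag-period : zigzag o i (period {m}) ≡ zigzag o i 0
  zigzag-period = trans (cong (zigzag o i) (sym (+-identityʳ (period {m})))) (zigzag-periodic o i 0)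

  InC⇒≢pole : ∀ {C : Map (suc m)} {x y w} → C pa ≡ c1 → x ≢ c1 → y ≢ c1 → InC x y (C w) → w ≢ pa
  InC⇒≢pole cp nx ny (inj₁ e) refl = nx (trans (sym e) cp)
  InC⇒≢pole cp nx ny (inj₂ e) refl = ny (trans (sym e) cp)

  α2-connected : ∀ w → InC α c2 (A w) → Path A α c2 (zigzag o i 0) w
  α2-connected w c with zigzag-covers o i w (InC⇒≢pole {C = A} A-pole α≢1 (λ ()) c)
  ... | p , h , refl = subst (λ z → Path A α c2 z (zigzag o i p)) zigzag-period
                          (Path-reverse c (ZigzagWalk.walk-up o i A α c2 0 (period {m}) L∈α2 walk-α2 p z≤n (<⇒≤ h) c))
    where
    L∈α2 : InC α c2 (A (zigzag o i (period {m})))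
    L∈α2 = subst (InC α c2) (cong A (sym zigzag-period)) (inj₁ (PA.prefix 0))

  module Swapα2 = KempeChange A α c2 α≢2 (λ w → InC α c2 (A w)) (λ w → InC? α c2 (A w)) (zigzag o i 0)
      (inj₁ (A-follows 0 (position<L 0))) (λ w s → s) (λ u w _ _ c → c) α2-connected

  A₁ : Map (suc m)
  A₁ = Swapα2.swapped

  A₁≡swap : ∀ w → A₁ w ≡ swap α c2 (A w)
  A₁≡swap w = go (InC? α c2 (A w))
    where
    go : Dec (InC α c2 (A w)) → A₁ w ≡ swap α c2 (A w)
    go (yes s) = Swapα2.swapped-in w s
    go (no ns) = trans (Swapα2.swapped-out w ns) (sym (swap-other α c2 (A w) (λ e → ns (inj₁ e)) (λ e → ns (inj₂ e))))

  wordA₁ : Pattern11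
  wordA₁ = mkPattern11 c2 β α c1 c2 β α c1 c2 β α c2 β α

  swapα2-α : swap α c2 α ≡ c2
  swapα2-α = swap-left α c2
  swapα2-2 : swap α c2 c2 ≡ α
  swapα2-2 = swap-right α c2 α≢2
  swapα2-β : swap α c2 β ≡ β
  swapα2-β = swap-other α c2 β (≢-sym α≢β) β≢2
  swapα2-1 : swap α c2 c1 ≡ c1
  swapα2-1 = swap-other α c2 c1 (≢-sym α≢1) (λ ())

  swap-wordA : ∀ p → swap α c2 (pattern11At wordA p) ≡ pattern11At wordA₁ p
  swap-wordA 0 = swapα2-α
  swap-wordA 1 = swapα2-β
  swap-wordA 2 = swapα2-2
  swap-wordA 3 = swapα2-1
  swap-wordA 4 = swapα2-α
  swap-wordA 5 = swapα2-β
  swap-wordA 6 = swapα2-2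
  swap-wordA 7 = swapα2-1
  swap-wordA 8 = swapα2-α
  swap-wordA 9 = swapα2-β
  swap-wordA 10 = swapα2-2
  swap-wordA (11+ k) = go k
    where
    go : ∀ k → swap α c2 (cycle3 α β c2 k) ≡ cycle3 c2 β α k
    go 0 = swapα2-α
    go 1 = swapα2-β
    go 2 = swapα2-2
    go (suc (suc (suc k))) = go k

  A₁-follows : ∀ p → p < period {m} → A₁ (zigzag o i p) ≡ pattern11At wordA₁ p
  A₁-follows p h = trans (A₁≡swap _) (trans (cong (swap α c2) (A-follows p h)) (swap-wordA p))

  module PA₁ = FollowsPattern11 o i A₁ wordA₁ R period≡ A₁-follows

  A₁-pole : A₁ pa ≡ c1
  A₁-pole = trans (A₁≡swap pa) (trans (cong (swap α c2) A-pole) swapα2-1)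

  Chain1β : V (suc m) → Set
  Chain1β w = w ≡ zigzag o i 1 ⊎ w ≡ zigzag o i 3 ⊎ w ≡ zigzag o i 5 ⊎ w ≡ zigzag o i 7 ⊎ w ≡ zigzag o i 9

  Chain1β? : ∀ w → Dec (Chain1β w)
  Chain1β? w = (w ≟ᵛ zigzag o i 1) ⊎-dec ((w ≟ᵛ zigzag o i 3) ⊎-dec
      ((w ≟ᵛ zigzag o i 5) ⊎-dec ((w ≟ᵛ zigzag o i 7) ⊎-dec (w ≟ᵛ zigzag o i 9))))

  ∉1β : ∀ {x} → x ≢ c1 → x ≢ β → ∀ {w} → A₁ w ≡ x → ¬ InC c1 β (A₁ w)
  ∉1β a b e c = ∉InC a b (subst (InC c1 β) e c)

  Chain1β-coloured : ∀ w → Chain1β w → InC c1 β (A₁ w)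
  Chain1β-coloured w (inj₁ refl) = inj₂ (PA₁.prefix 1)
  Chain1β-coloured w (inj₂ (inj₁ refl)) = inj₁ (PA₁.prefix 3)
  Chain1β-coloured w (inj₂ (inj₂ (inj₁ refl))) = inj₂ (PA₁.prefix 5)
  Chain1β-coloured w (inj₂ (inj₂ (inj₂ (inj₁ refl)))) = inj₁ (PA₁.prefix 7)
  Chain1β-coloured w (inj₂ (inj₂ (inj₂ (inj₂ refl)))) = inj₂ (PA₁.prefix 9)

  Only1β : V (suc m) → Set
  Only1β w = InC c1 β (A₁ w) → Chain1β w

  2∉1β : ∀ p → {T (p <ᵇ 14)} → pattern11At wordA₁ p ≡ c2 → Only1β (zigzag o i p)
  2∉1β p {h} e c = ⊥-elim (∉1β (λ ()) (≢-sym β≢2) (trans (PA₁.prefix p {h}) e) c)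
  α∉1β : ∀ p → {T (p <ᵇ 14)} → pattern11At wordA₁ p ≡ α → Only1β (zigzag o i p)
  α∉1β p {h} e c = ⊥-elim (∉1β α≢1 α≢β (trans (PA₁.prefix p {h}) e) c)

  Chain1β-closed : ∀ u w → Chain1β u → Adj u w → InC c1 β (A₁ w) → Chain1β w
  Chain1β-closed u w (inj₁ refl) a = neighbours-of-1-satisfy Only1β (λ c → ⊥-elim (∉1β α≢1 α≢β PA₁.col-last c))
      (2∉1β 0 refl) (α∉1β 2 refl) (λ _ → inj₂ (inj₁ refl)) w a
  Chain1β-closed u w (inj₂ (inj₁ refl)) a = neighbours-satisfy Only1β 1 (⊥-elim ∘ odd-not-even 0) (λ _ → inj₁ refl)
      (α∉1β 2 refl) (2∉1β 4 refl) (λ _ → inj₂ (inj₂ (inj₁ refl))) w a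
  Chain1β-closed u w (inj₂ (inj₂ (inj₁ refl))) a = neighbours-satisfy Only1β 3 (⊥-elim ∘ odd-not-even 1)
      (λ _ → inj₂ (inj₁ refl)) (2∉1β 4 refl) (α∉1β 6 refl) (λ _ → inj₂ (inj₂ (inj₂ (inj₁ refl)))) w a
  Chain1β-closed u w (inj₂ (inj₂ (inj₂ (inj₁ refl)))) a = neighbours-satisfy Only1β 5 (⊥-elim ∘ odd-not-even 2)
      (λ _ → inj₂ (inj₂ (inj₁ refl))) (α∉1β 6 refl) (2∉1β 8 refl) (λ _ → inj₂ (inj₂ (inj₂ (inj₂ refl)))) w a
  Chain1β-closed u w (inj₂ (inj₂ (inj₂ (inj₂ refl)))) a = neighbours-satisfy Only1β 7 (⊥-elim ∘ odd-not-even 3)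
      (λ _ → inj₂ (inj₂ (inj₂ (inj₁ refl)))) (2∉1β 8 refl) (α∉1β 10 refl) (2∉1β 11 refl) w a

  chain-step : ∀ k → Chain1β (zigzag o i k) → Chain1β (zigzag o i (2 + k)) →
               Path A₁ c1 β (zigzag o i k) (zigzag o i (2 + k))
  chain-step k s s' = step (Chain1β-coloured _ s) (zigzag-adj₂ o i k) (Chain1β-coloured _ s') here

  p13 = chain-step 1 (inj₁ refl) (inj₂ (inj₁ refl))
  p35 = chain-step 3 (inj₂ (inj₁ refl)) (inj₂ (inj₂ (inj₁ refl)))
  p57 = chain-step 5 (inj₂ (inj₂ (inj₁ refl))) (inj₂ (inj₂ (inj₂ (inj₁ refl))))
  p79 = chain-step 7 (inj₂ (inj₂ (inj₂ (inj₁ refl)))) (inj₂ (inj₂ (inj₂ (inj₂ refl))))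

  Chain1β-connected : ∀ w → Chain1β w → Path A₁ c1 β (zigzag o i 1) w
  Chain1β-connected w (inj₁ refl) = here
  Chain1β-connected w (inj₂ (inj₁ refl)) = p13
  Chain1β-connected w (inj₂ (inj₂ (inj₁ refl))) = Path-++ p13 p35
  Chain1β-connected w (inj₂ (inj₂ (inj₂ (inj₁ refl)))) = Path-++ p13 (Path-++ p35 p57)
  Chain1β-connected w (inj₂ (inj₂ (inj₂ (inj₂ refl)))) = Path-++ p13 (Path-++ p35 (Path-++ p57 p79))

  module Swap1β = KempeChange A₁ c1 β (≢-sym β≢1) Chain1β Chain1β? (zigzag o i 1) (inj₁ refl) Chain1β-coloured
      Chain1β-closed Chain1β-connected

  A₂ : Map (suc m)
  A₂ = Swap1β.swapped

  pole∉Chain1β : ¬ Chain1β pa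
  pole∉Chain1β (inj₁ e) = zigzag≢pole o i 1 (sym e)
  pole∉Chain1β (inj₂ (inj₁ e)) = zigzag≢pole o i 3 (sym e)
  pole∉Chain1β (inj₂ (inj₂ (inj₁ e))) = zigzag≢pole o i 5 (sym e)
  pole∉Chain1β (inj₂ (inj₂ (inj₂ (inj₁ e)))) = zigzag≢pole o i 7 (sym e)
  pole∉Chain1β (inj₂ (inj₂ (inj₂ (inj₂ e)))) = zigzag≢pole o i 9 (sym e)

  Chain1β-proper : ProperChain A₁ c1 β (zigzag o i 1)
  Chain1β-proper = Swap1β.proper-chain pa (inj₁ A₁-pole) pole∉Chain1β

  A₂-pole : A₂ pa ≡ c1
  A₂-pole = trans (Swap1β.swapped-out pa pole∉Chain1β) A₁-pole

  ∉Chain1β : ∀ p → p < period {m} → p ≢ 1 → p ≢ 3 → p ≢ 5 → p ≢ 7 → p ≢ 9 → ¬ Chain1β (zigzag o i p)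
  ∉Chain1β p h n1 n3 n5 n7 n9 (inj₁ e) = n1 (same-position 1 h e)
  ∉Chain1β p h n1 n3 n5 n7 n9 (inj₂ (inj₁ e)) = n3 (same-position 3 h e)
  ∉Chain1β p h n1 n3 n5 n7 n9 (inj₂ (inj₂ (inj₁ e))) = n5 (same-position 5 h e)
  ∉Chain1β p h n1 n3 n5 n7 n9 (inj₂ (inj₂ (inj₂ (inj₁ e)))) = n7 (same-position 7 h e)
  ∉Chain1β p h n1 n3 n5 n7 n9 (inj₂ (inj₂ (inj₂ (inj₂ e)))) = n9 (same-position 9 h e)

  wordA₂ : Pattern11
  wordA₂ = mkPattern11 c2 c1 α β c2 c1 α β c2 c1 α c2 β α

  swap1β-β : swap c1 β β ≡ c1
  swap1β-β = swap-right c1 β (≢-sym β≢1)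
  swap1β-1 : swap c1 β c1 ≡ β
  swap1β-1 = swap-left c1 β

  outside-Chain1β : ∀ p → p < period {m} → p ≢ 1 → p ≢ 3 → p ≢ 5 → p ≢ 7 → p ≢ 9 →
                    pattern11At wordA₁ p ≡ pattern11At wordA₂ p → A₂ (zigzag o i p) ≡ pattern11At wordA₂ p
  outside-Chain1β p h a b' c d e q = trans (Swap1β.swapped-out _ (∉Chain1β p h a b' c d e)) (trans (A₁-follows p h) q)

  A₂-follows : ∀ p → p < period {m} → A₂ (zigzag o i p) ≡ pattern11At wordA₂ p
  A₂-follows 1 h = trans (Swap1β.swapped-in _ (inj₁ refl)) (trans (cong (swap c1 β) (A₁-follows 1 h)) swap1β-β)
  A₂-follows 3 h = trans (Swap1β.swapped-in _ (inj₂ (inj₁ refl))) (trans (cong (swap c1 β) (A₁-follows 3 h)) swap1β-1)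
  A₂-follows 5 h = trans (Swap1β.swapped-in _ (inj₂ (inj₂ (inj₁ refl))))
      (trans (cong (swap c1 β) (A₁-follows 5 h)) swap1β-β)
  A₂-follows 7 h = trans (Swap1β.swapped-in _ (inj₂ (inj₂ (inj₂ (inj₁ refl)))))
      (trans (cong (swap c1 β) (A₁-follows 7 h)) swap1β-1)
  A₂-follows 9 h = trans (Swap1β.swapped-in _ (inj₂ (inj₂ (inj₂ (inj₂ refl)))))
      (trans (cong (swap c1 β) (A₁-follows 9 h)) swap1β-β)
  A₂-follows 0 h = outside-Chain1β 0 h (λ ()) (λ ()) (λ ()) (λ ()) (λ ()) refl
  A₂-follows 2 h = outside-Chain1β 2 h (λ ()) (λ ()) (λ ()) (λ ()) (λ ()) refl
  A₂-follows 4 h = outside-Chain1β 4 h (λ ()) (λ ()) (λ ()) (λ ()) (λ ()) refl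
  A₂-follows 6 h = outside-Chain1β 6 h (λ ()) (λ ()) (λ ()) (λ ()) (λ ()) refl
  A₂-follows 8 h = outside-Chain1β 8 h (λ ()) (λ ()) (λ ()) (λ ()) (λ ()) refl
  A₂-follows 10 h = outside-Chain1β 10 h (λ ()) (λ ()) (λ ()) (λ ()) (λ ()) refl
  A₂-follows (11+ k) h = outside-Chain1β _ h (λ ()) (λ ()) (λ ()) (λ ()) (λ ()) refl

  module PA₂ = FollowsPattern11 o i A₂ wordA₂ R period≡ A₂-follows

  via-A₂ : ∀ {k C} → EquivUpTo k A₂ C → EquivUpTo (suc k) A C
  via-A₂ rest = impr α c2 (zigzag o i 0) Swapα2.kempe (Swapα2.improper-chain (λ _ c → c))
                  (prop c1 β (zigzag o i 1) Swap1β.kempe Chain1β-proper rest)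

  module Forward where
    Kept : V (suc m) → Set
    Kept w = w ≡ zigzag o i 3 ⊎ w ≡ zigzag o i 4 ⊎ w ≡ zigzag o i 7 ⊎ w ≡ zigzag o i 8

    Kept? : ∀ w → Dec (Kept w)
    Kept? w = (w ≟ᵛ zigzag o i 3) ⊎-dec ((w ≟ᵛ zigzag o i 4) ⊎-dec ((w ≟ᵛ zigzag o i 7) ⊎-dec (w ≟ᵛ zigzag o i 8)))

    Chain₃ : V (suc m) → Set
    Chain₃ w = InC c2 β (A₂ w) × ¬ Kept w

    Chain₃? : ∀ w → Dec (Chain₃ w)
    Chain₃? w = InC? c2 β (A₂ w) ×-dec ¬? (Kept? w)

    ∉Kept : ∀ p → p < period {m} → p ≢ 3 → p ≢ 4 → p ≢ 7 → p ≢ 8 → ¬ Kept (zigzag o i p)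
    ∉Kept p h a b' c d (inj₁ e) = a (same-position 3 h e)
    ∉Kept p h a b' c d (inj₂ (inj₁ e)) = b' (same-position 4 h e)
    ∉Kept p h a b' c d (inj₂ (inj₂ (inj₁ e))) = c (same-position 7 h e)
    ∉Kept p h a b' c d (inj₂ (inj₂ (inj₂ e))) = d (same-position 8 h e)

    OnlyKept : V (suc m) → Set
    OnlyKept w = InC c2 β (A₂ w) → Kept w

    1∉chain : ∀ p → {T (p <ᵇ 14)} → pattern11At wordA₂ p ≡ c1 → OnlyKept (zigzag o i p)
    1∉chain p {h} e c = ⊥-elim (∉InC (λ ()) (≢-sym β≢1) (subst (InC c2 β) (trans (PA₂.prefix p {h}) e) c))
    α∉chain : ∀ p → {T (p <ᵇ 14)} → pattern11At wordA₂ p ≡ α → OnlyKept (zigzag o i p)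
    α∉chain p {h} e c = ⊥-elim (∉InC α≢2 α≢β (subst (InC c2 β) (trans (PA₂.prefix p {h}) e) c))
    pole∉chain : ∀ {q} → Even q → OnlyKept pa
    pole∉chain _ c = ⊥-elim (∉InC (λ ()) (≢-sym β≢1) (subst (InC c2 β) A₂-pole c))

    Kept-closed : ∀ e w → Kept e → Adj e w → InC c2 β (A₂ w) → Kept w
    Kept-closed e w (inj₁ refl) a = neighbours-satisfy OnlyKept 1 (⊥-elim ∘ odd-not-even 0) (1∉chain 1 refl)
        (α∉chain 2 refl) (λ _ → inj₂ (inj₁ refl)) (1∉chain 5 refl) w a
    Kept-closed e w (inj₂ (inj₁ refl)) a = neighbours-satisfy OnlyKept 2 pole∉chain (α∉chain 2 refl) (λ _ → inj₁ refl)
        (1∉chain 5 refl) (α∉chain 6 refl) w a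
    Kept-closed e w (inj₂ (inj₂ (inj₁ refl))) a = neighbours-satisfy OnlyKept 5 (⊥-elim ∘ odd-not-even 2)
        (1∉chain 5 refl) (α∉chain 6 refl) (λ _ → inj₂ (inj₂ (inj₂ refl))) (1∉chain 9 refl) w a
    Kept-closed e w (inj₂ (inj₂ (inj₂ refl))) a = neighbours-satisfy OnlyKept 6 pole∉chain (α∉chain 6 refl)
        (λ _ → inj₂ (inj₂ (inj₁ refl))) (1∉chain 9 refl) (α∉chain 10 refl) w a

    Chain₃-closed : ∀ u w → Chain₃ u → Adj u w → InC c2 β (A₂ w) → Chain₃ w
    Chain₃-closed u w su a c = c , (λ ew → proj₂ su (Kept-closed w u ew (sy a) (proj₁ su)))

    walk₃ : ∀ p → 11 ≤ p → p < period {m} → InC c2 β (A₂ (zigzag o i p)) →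
           InC c2 β (A₂ (zigzag o i (suc p))) ⊎ (InC c2 β (A₂ (zigzag o i (2 + p))) × 2 + p ≤ period {m})
    walk₃ p 11≤p h c with m≤n⇒∃[o]m+o≡n 11≤p
    ... | k , refl with residue3 k
    ...   | 0mod3 q = inj₁ (inj₂ (PA₂.col-in-block q 0 1 (<-fromᵇ 1 3) h))
    ...   | 1mod3 q = inj₂ (inj₁ (PA₂.col-after-block q 1 2 refl (<-fromᵇ 1 3) h refl) , PA₂.block+2≤L q 1
        (<-fromᵇ 1 2) h)
    ...   | 2mod3 q = ⊥-elim (∉InC α≢2 α≢β (subst (InC c2 β) (PA₂.col-block q 2 h) c))

    col-L∈chain : InC c2 β (A₂ (zigzag o i (period {m})))
    col-L∈chain = inj₁ PA₂.col-L

    start∈Chain₃ : Chain₃ (zigzag o i 0)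
    start∈Chain₃ = inj₁ (PA₂.prefix 0) , ∉Kept 0 (position<L 0) (λ ()) (λ ()) (λ ()) (λ ())

    Chain₃-connected : ∀ w → Chain₃ w → Path A₂ c2 β (zigzag o i 0) w
    Chain₃-connected w (c , ne) with zigzag-covers o i w (InC⇒≢pole {C = A₂} A₂-pole (λ ()) β≢1 c)
    ... | p , h , refl with p <? 11
    ... | no p≮11 = subst (λ z → Path A₂ c2 β z (zigzag o i p)) zigzag-period
             (Path-reverse c (ZigzagWalk.walk-up o i A₂ c2 β 11 (period {m}) col-L∈chain walk₃ p (≮⇒≥ p≮11) (<⇒≤ h) c))
    ... | yes p<11 = at p p<11 c ne
      where
      excluded : ∀ {x} → x ≢ c2 → x ≢ β → ∀ p → A₂ (zigzag o i p) ≡ x → InC c2 β (A₂ (zigzag o i p)) → ⊥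
      excluded a b' p e c' = ∉InC a b' (subst (InC c2 β) e c')
      at : ∀ p → p < 11 → InC c2 β (A₂ (zigzag o i p)) → ¬ Kept (zigzag o i p) → Path A₂ c2 β (zigzag o i 0)
          (zigzag o i p)
      at 0 _ _ _ = here
      at 1 _ c ne = ⊥-elim (excluded (λ ()) (≢-sym β≢1) 1 (PA₂.prefix 1) c)
      at 2 _ c ne = ⊥-elim (excluded α≢2 α≢β 2 (PA₂.prefix 2) c)
      at 3 _ c ne = ⊥-elim (ne (inj₁ refl))
      at 4 _ c ne = ⊥-elim (ne (inj₂ (inj₁ refl)))
      at 5 _ c ne = ⊥-elim (excluded (λ ()) (≢-sym β≢1) 5 (PA₂.prefix 5) c)
      at 6 _ c ne = ⊥-elim (excluded α≢2 α≢β 6 (PA₂.prefix 6) c)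
      at 7 _ c ne = ⊥-elim (ne (inj₂ (inj₂ (inj₁ refl))))
      at 8 _ c ne = ⊥-elim (ne (inj₂ (inj₂ (inj₂ refl))))
      at 9 _ c ne = ⊥-elim (excluded (λ ()) (≢-sym β≢1) 9 (PA₂.prefix 9) c)
      at 10 _ c ne = ⊥-elim (excluded α≢2 α≢β 10 (PA₂.prefix 10) c)
      at (11+ _) p<11 _ _ = ⊥-elim (<⇒≱ p<11 (+-monoʳ-≤ 11 z≤n))

    module Swap₃ = KempeChange A₂ c2 β (≢-sym β≢2) Chain₃ Chain₃? (zigzag o i 0) start∈Chain₃ (λ w s → proj₁ s)
        Chain₃-closed Chain₃-connected

    A₃ : Map (suc m)
    A₃ = Swap₃.swapped

    Chain₃-proper : ProperChain A₂ c2 β (zigzag o i 0)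
    Chain₃-proper = Swap₃.proper-chain (zigzag o i 3) (inj₂ (PA₂.prefix 3)) (λ s → proj₂ s (inj₁ refl))

    wordA₃ : Pattern11
    wordA₃ = mkPattern11 β c1 α β c2 c1 α β c2 c1 α β c2 α

    swap₃-2 : swap c2 β c2 ≡ β
    swap₃-2 = swap-left c2 β
    swap₃-β : swap c2 β β ≡ c2
    swap₃-β = swap-right c2 β (≢-sym β≢2)

    outside-colours : ∀ p → p < period {m} → ∀ {x} → A₂ (zigzag o i p) ≡ x → x ≢ c2 → x ≢ β → A₃ (zigzag o i p) ≡ x
    outside-colours p h e a b' = trans (Swap₃.swapped-out (zigzag o i p)
        (λ s → ∉InC a b' (subst (InC c2 β) e (proj₁ s)))) e
    outside-kept : ∀ p → p < period {m} → Kept (zigzag o i p) → A₃ (zigzag o i p) ≡ A₂ (zigzag o i p)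
    outside-kept p h ee = Swap₃.swapped-out (zigzag o i p) (λ s → proj₂ s ee)

    A₃-follows : ∀ p → p < period {m} → A₃ (zigzag o i p) ≡ pattern11At wordA₃ p
    A₃-follows 0 h = trans (Swap₃.swapped-in (zigzag o i 0) start∈Chain₃)
        (trans (cong (swap c2 β) (A₂-follows 0 h)) swap₃-2)
    A₃-follows 1 h = outside-colours 1 h (A₂-follows 1 h) (λ ()) (≢-sym β≢1)
    A₃-follows 2 h = outside-colours 2 h (A₂-follows 2 h) α≢2 α≢β
    A₃-follows 3 h = trans (outside-kept 3 h (inj₁ refl)) (A₂-follows 3 h)
    A₃-follows 4 h = trans (outside-kept 4 h (inj₂ (inj₁ refl))) (A₂-follows 4 h)
    A₃-follows 5 h = outside-colours 5 h (A₂-follows 5 h) (λ ()) (≢-sym β≢1)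
    A₃-follows 6 h = outside-colours 6 h (A₂-follows 6 h) α≢2 α≢β
    A₃-follows 7 h = trans (outside-kept 7 h (inj₂ (inj₂ (inj₁ refl)))) (A₂-follows 7 h)
    A₃-follows 8 h = trans (outside-kept 8 h (inj₂ (inj₂ (inj₂ refl)))) (A₂-follows 8 h)
    A₃-follows 9 h = outside-colours 9 h (A₂-follows 9 h) (λ ()) (≢-sym β≢1)
    A₃-follows 10 h = outside-colours 10 h (A₂-follows 10 h) α≢2 α≢β
    A₃-follows (11+ k) h with residue3 k
    ... | 0mod3 q = trans (Swap₃.swapped-in _ (inj₁ (PA₂.col-block q 0 h) , ∉Kept _ h (λ ()) (λ ()) (λ ()) (λ ())))
                          (trans (cong (swap c2 β) (PA₂.col-block q 0 h))
                              (trans swap₃-2 (sym (cycle3-periodic β c2 α q 0))))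
    ... | 1mod3 q = trans (Swap₃.swapped-in _ (inj₂ (PA₂.col-block q 1 h) , ∉Kept _ h (λ ()) (λ ()) (λ ()) (λ ())))
                          (trans (cong (swap c2 β) (PA₂.col-block q 1 h))
                              (trans swap₃-β (sym (cycle3-periodic β c2 α q 1))))
    ... | 2mod3 q = trans (outside-colours _ h (PA₂.col-block q 2 h) α≢2 α≢β) (sym (cycle3-periodic β c2 α q 2))

    module PA₃ = FollowsPattern11 o i A₃ wordA₃ R period≡ A₃-follows

    A₃-pole : A₃ pa ≡ c1
    A₃-pole = trans (Swap₃.swapped-out pa (λ s → ∉InC (λ ()) (≢-sym β≢1) (subst (InC c2 β) A₂-pole (proj₁ s)))) A₂-pole

    Only₄ : V (suc m) → Set
    Only₄ w = InC c1 c2 (A₃ w) → w ≡ zigzag o i 1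

    ∉pair₄ : ∀ {x} → x ≢ c1 → x ≢ c2 → ∀ {w} → A₃ w ≡ x → Only₄ w
    ∉pair₄ x≢1 x≢2 e c = ⊥-elim (∉InC x≢1 x≢2 (subst (InC c1 c2) e c))

    1-isolated : ∀ u w → u ≡ zigzag o i 1 → Adj u w → InC c1 c2 (A₃ w) → w ≡ zigzag o i 1
    1-isolated _ w refl = neighbours-of-1-satisfy Only₄ (∉pair₄ α≢1 α≢2 PA₃.col-last) (∉pair₄ β≢1 β≢2 (PA₃.prefix 0))
                                         (∉pair₄ α≢1 α≢2 (PA₃.prefix 2)) (∉pair₄ β≢1 β≢2 (PA₃.prefix 3)) w

    module Swap₄ = KempeChange A₃ c1 c2 (λ ()) (_≡ zigzag o i 1) (_≟ᵛ zigzag o i 1) (zigzag o i 1) refl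
                     (λ w e → subst (λ z → InC c1 c2 (A₃ z)) (sym e) (inj₁ (PA₃.prefix 1))) 1-isolated
                     (λ w e → subst (Path A₃ c1 c2 (zigzag o i 1)) (sym e) here)

    B : Map (suc m)
    B = Swap₄.swapped

    Swap₄-proper : ProperChain A₃ c1 c2 (zigzag o i 1)
    Swap₄-proper = Swap₄.proper-chain pa (inj₁ A₃-pole) (λ e → zigzag≢pole o i 1 (sym e))

    B-pole : B pa ≡ c1
    B-pole = trans (Swap₄.swapped-out pa (λ e → zigzag≢pole o i 1 (sym e))) A₃-pole

    wordB : Pattern11
    wordB = mkPattern11 β c2 α β c2 c1 α β c2 c1 α β c2 α

    wordA₃≡wordB : ∀ p → pattern11At wordA₃ (suc (suc p)) ≡ pattern11At wordB (suc (suc p))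
    wordA₃≡wordB 0 = refl
    wordA₃≡wordB 1 = refl
    wordA₃≡wordB 2 = refl
    wordA₃≡wordB 3 = refl
    wordA₃≡wordB 4 = refl
    wordA₃≡wordB 5 = refl
    wordA₃≡wordB 6 = refl
    wordA₃≡wordB 7 = refl
    wordA₃≡wordB 8 = refl
    wordA₃≡wordB (suc (suc (suc (suc (suc (suc (suc (suc (suc k))))))))) = refl

    B-follows : ∀ p → p < period {m} → B (zigzag o i p) ≡ pattern11At wordB p
    B-follows 1 h = trans (Swap₄.swapped-in (zigzag o i 1) refl)
        (trans (cong (swap c1 c2) (A₃-follows 1 h)) (swap-left c1 c2))
    B-follows 0 h = trans (Swap₄.swapped-out (zigzag o i 0) (λ e → 0≢1 (same-position 1 h e))) (A₃-follows 0 h)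
      where 0≢1 : 0 ≢ 1
            0≢1 ()
    B-follows (suc (suc p)) h = trans (Swap₄.swapped-out (zigzag o i (2 + p)) (λ e → n (same-position 1 h e)))
        (trans (A₃-follows (2 + p) h) (wordA₃≡wordB p))
      where n : 2 + p ≢ 1
            n ()

    cycle3-shift₁ : ∀ k → cycle3 α β c2 (suc k) ≡ cycle3 β c2 α k
    cycle3-shift₁ 0 = refl
    cycle3-shift₁ 1 = refl
    cycle3-shift₁ 2 = refl
    cycle3-shift₁ (suc (suc (suc k))) = cycle3-shift₁ k

    wordB-shifted : ∀ p → pattern11At wordB (2 + p) ≡ patternAt (canonical α β) p
    wordB-shifted 0 = refl
    wordB-shifted 1 = refl
    wordB-shifted 2 = refl
    wordB-shifted 3 = refl
    wordB-shifted 4 = refl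
    wordB-shifted 5 = refl
    wordB-shifted 6 = refl
    wordB-shifted 7 = refl
    wordB-shifted 8 = refl
    wordB-shifted (suc (suc (suc (suc (suc (suc (suc (suc (suc k))))))))) = sym (cycle3-shift₁ k)

    B-follows-canonical : ∀ p → p < period {m} → B (zigzag o (move o i) p) ≡ patternAt (canonical α β) p
    B-follows-canonical p h with <-cmp (2 + p) (period {m})
    ... | tri< l _ _ = trans (B-follows (2 + p) l) (wordB-shifted p)
    ... | tri≈ _ e _ = trans (cong B (trans (cong (zigzag o i) e) zigzag-period)) (trans (B-follows 0 (position<L 0))
                         (sym (trans (cong (patternAt (canonical α β)) pe)
                             (trans (cong (cycle3 α β c2) (+-comm 4 (R * 3))) (cycle3-periodic α β c2 R 4)))))
      where
      pe : p ≡ 12 + R * 3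
      pe = suc-injective (suc-injective (trans e period≡))
    ... | tri> _ _ g = trans (cong B (trans (cong (zigzag o i) e1)
                                          (trans (cong (zigzag o i) (+-comm 1 (period {m}))) (zigzag-periodic o i 1))))
                         (trans (B-follows 1 (position<L 1))
                         (sym (trans (cong (patternAt (canonical α β)) pe)
                             (trans (cong (cycle3 α β c2) (+-comm 5 (R * 3))) (cycle3-periodic α β c2 R 5)))))
      where
      e1 : 2 + p ≡ suc (period {m})
      e1 = ≤-antisym (s≤s h) g
      pe : p ≡ 13 + R * 3
      pe = suc-injective (suc-injective (trans e1 (cong suc period≡)))

    module CB = CanonicalColouring o (move o i) αβ R period≡ B B-pole B-follows-canonical

    result : Σ (Map (suc m)) λ B′ → NormColouring B′ × EquivUpTo 3 A B′ × Good B′ × ChainOf34 B′ (zigzagEdge o i 6)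
    result = B , CB.normColouring ,
             via-A₂ (prop c2 β (zigzag o i 0) Swap₃.kempe Chain₃-proper
                 (prop c1 c2 (zigzag o i 1) Swap₄.kempe Swap₄-proper done)) ,
             CB.good , CB.chain (zigzagEdge o i 6) (ends-edge₀ o (move o (move o (move o i))))

  module Backward where
    Kept : V (suc m) → Set
    Kept w = w ≡ zigzag o i 2 ⊎ w ≡ zigzag o i 3 ⊎ w ≡ zigzag o i 6 ⊎ w ≡ zigzag o i 7

    Kept? : ∀ w → Dec (Kept w)
    Kept? w = (w ≟ᵛ zigzag o i 2) ⊎-dec ((w ≟ᵛ zigzag o i 3) ⊎-dec ((w ≟ᵛ zigzag o i 6) ⊎-dec (w ≟ᵛ zigzag o i 7)))

    Chain₃ : V (suc m) → Set
    Chain₃ w = InC α β (A₂ w) × ¬ Kept w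

    Chain₃? : ∀ w → Dec (Chain₃ w)
    Chain₃? w = InC? α β (A₂ w) ×-dec ¬? (Kept? w)

    ∉Kept : ∀ p → p < period {m} → p ≢ 2 → p ≢ 3 → p ≢ 6 → p ≢ 7 → ¬ Kept (zigzag o i p)
    ∉Kept p h a b' c d (inj₁ e) = a (same-position 2 h e)
    ∉Kept p h a b' c d (inj₂ (inj₁ e)) = b' (same-position 3 h e)
    ∉Kept p h a b' c d (inj₂ (inj₂ (inj₁ e))) = c (same-position 6 h e)
    ∉Kept p h a b' c d (inj₂ (inj₂ (inj₂ e))) = d (same-position 7 h e)

    OnlyKept : V (suc m) → Set
    OnlyKept w = InC α β (A₂ w) → Kept w

    1∉chain : ∀ p → {T (p <ᵇ 14)} → pattern11At wordA₂ p ≡ c1 → OnlyKept (zigzag o i p)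
    1∉chain p {h} e c = ⊥-elim (∉InC (≢-sym α≢1) (≢-sym β≢1) (subst (InC α β) (trans (PA₂.prefix p {h}) e) c))
    2∉chain : ∀ p → {T (p <ᵇ 14)} → pattern11At wordA₂ p ≡ c2 → OnlyKept (zigzag o i p)
    2∉chain p {h} e c = ⊥-elim (∉InC (≢-sym α≢2) (≢-sym β≢2) (subst (InC α β) (trans (PA₂.prefix p {h}) e) c))
    pole∉chain : ∀ {q} → Even q → OnlyKept pa
    pole∉chain _ c = ⊥-elim (∉InC (≢-sym α≢1) (≢-sym β≢1) (subst (InC α β) A₂-pole c))

    Kept-closed : ∀ e w → Kept e → Adj e w → InC α β (A₂ w) → Kept w
    Kept-closed e w (inj₁ refl) a = neighbours-satisfy OnlyKept 0 pole∉chain (2∉chain 0 refl) (1∉chain 1 refl)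
        (λ _ → inj₂ (inj₁ refl)) (2∉chain 4 refl) w a
    Kept-closed e w (inj₂ (inj₁ refl)) a = neighbours-satisfy OnlyKept 1 pole∉chain (1∉chain 1 refl) (λ _ → inj₁ refl)
        (2∉chain 4 refl) (1∉chain 5 refl) w a
    Kept-closed e w (inj₂ (inj₂ (inj₁ refl))) a = neighbours-satisfy OnlyKept 4 pole∉chain (2∉chain 4 refl)
        (1∉chain 5 refl) (λ _ → inj₂ (inj₂ (inj₂ refl))) (2∉chain 8 refl) w a
    Kept-closed e w (inj₂ (inj₂ (inj₂ refl))) a = neighbours-satisfy OnlyKept 5 pole∉chain (1∉chain 5 refl)
        (λ _ → inj₂ (inj₂ (inj₁ refl))) (2∉chain 8 refl) (1∉chain 9 refl) w a

    Chain₃-closed : ∀ u w → Chain₃ u → Adj u w → InC α β (A₂ w) → Chain₃ w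
    Chain₃-closed u w su a c = c , (λ ew → proj₂ su (Kept-closed w u ew (sy a) (proj₁ su)))

    hi : ℕ
    hi = 11 + (R * 3 + 2)

    hi<L : hi < period {m}
    hi<L = PA₂.last-block<L 2 (<-fromᵇ 2 3)

    hi∈chain : InC α β (A₂ (zigzag o i hi))
    hi∈chain = inj₁ (PA₂.col-block R 2 hi<L)

    walk₃ : ∀ p → 10 ≤ p → p < hi → InC α β (A₂ (zigzag o i p)) →
           InC α β (A₂ (zigzag o i (suc p))) ⊎ (InC α β (A₂ (zigzag o i (2 + p))) × 2 + p ≤ hi)
    walk₃ p 10≤p h c with m≤n⇒∃[o]m+o≡n 10≤p
    ... | zero , refl = inj₂ (inj₂ (PA₂.prefix 12) , +-monoʳ-≤ 11 {1} (≤-trans (s≤s z≤n) (m≤n+m 2 (R * 3))))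
    ... | suc k , refl with residue3 k
    ...   | 0mod3 q = ⊥-elim (∉InC (≢-sym α≢2) (≢-sym β≢2) (subst (InC α β) (PA₂.col-block q 0 (<-trans h hi<L)) c))
    ...   | 1mod3 q = inj₁ (inj₁ (PA₂.col-in-block q 1 1 (<-fromᵇ 2 3) (<-trans h hi<L)))
    ...   | 2mod3 q = inj₂ (inj₂ (trans (cong (λ z → A₂ (zigzag o i z)) block+2≡)
        (PA₂.col-block (suc q) 1 (≤-<-trans next≤hi hi<L))) ,
                        subst (_≤ hi) (sym block+2≡) next≤hi)
      where
      block+2≡ : 2 + (11 + (q * 3 + 2)) ≡ 11 + (suc q * 3 + 1)
      block+2≡ = trans (PA₂.+-block 2 q 2) (PA₂.block-3 q 1)
      next-block : suc q * 3 ≤ R * 3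
      next-block = next-block≤ q R 0 (subst (_< R * 3) (sym (+-identityʳ (q * 3)))
                     (+-cancelʳ-< 2 (q * 3) (R * 3) (+-cancelˡ-< 11 (q * 3 + 2) (R * 3 + 2) h)))
      next≤hi : 11 + (suc q * 3 + 1) ≤ hi
      next≤hi = +-monoʳ-≤ 11 (+-mono-≤ next-block (s≤s z≤n))

    1+hi≡L : suc hi ≡ period {m}
    1+hi≡L = trans (cong (12 +_) (+-comm (R * 3) 2)) (sym period≡)

    10∈chain : InC α β (A₂ (zigzag o i 10))
    10∈chain = inj₁ (PA₂.prefix 10)

    path-10-hi : Path A₂ α β (zigzag o i 10) (zigzag o i hi)
    path-10-hi = ZigzagWalk.walk-up o i A₂ α β 10 hi hi∈chain walk₃ 10 ≤-refl
        (≤-trans (<⇒≤ (<-fromᵇ 10 11)) (m≤m+n 11 _)) 10∈chain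

    tail-connected : ∀ p → 10 ≤ p → p < period {m} → InC α β (A₂ (zigzag o i p)) → Path A₂ α β (zigzag o i 10)
        (zigzag o i p)
    tail-connected p l h c = Path-++ path-10-hi (Path-reverse c
        (ZigzagWalk.walk-up o i A₂ α β 10 hi hi∈chain walk₃ p l (≤-pred (subst (p <_) (sym 1+hi≡L) h)) c))

    start∈Chain₃ : Chain₃ (zigzag o i 10)
    start∈Chain₃ = 10∈chain , ∉Kept 10 (position<L 10) (λ ()) (λ ()) (λ ()) (λ ())

    Chain₃-connected : ∀ w → Chain₃ w → Path A₂ α β (zigzag o i 10) w
    Chain₃-connected w (c , ne) with zigzag-covers o i w (InC⇒≢pole {C = A₂} A₂-pole α≢1 β≢1 c)
    ... | p , h , refl = at p h c ne
      where
      excluded : ∀ {x} → x ≢ α → x ≢ β → ∀ p → A₂ (zigzag o i p) ≡ x → InC α β (A₂ (zigzag o i p)) → ⊥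
      excluded a b' p e c' = ∉InC a b' (subst (InC α β) e c')
      at : ∀ p → p < period {m} → InC α β (A₂ (zigzag o i p)) → ¬ Kept (zigzag o i p) → Path A₂ α β (zigzag o i 10)
          (zigzag o i p)
      at 0 _ c ne = ⊥-elim (excluded (≢-sym α≢2) (≢-sym β≢2) 0 (PA₂.prefix 0) c)
      at 1 _ c ne = ⊥-elim (excluded (≢-sym α≢1) (≢-sym β≢1) 1 (PA₂.prefix 1) c)
      at 2 _ c ne = ⊥-elim (ne (inj₁ refl))
      at 3 _ c ne = ⊥-elim (ne (inj₂ (inj₁ refl)))
      at 4 _ c ne = ⊥-elim (excluded (≢-sym α≢2) (≢-sym β≢2) 4 (PA₂.prefix 4) c)
      at 5 _ c ne = ⊥-elim (excluded (≢-sym α≢1) (≢-sym β≢1) 5 (PA₂.prefix 5) c)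
      at 6 _ c ne = ⊥-elim (ne (inj₂ (inj₂ (inj₁ refl))))
      at 7 _ c ne = ⊥-elim (ne (inj₂ (inj₂ (inj₂ refl))))
      at 8 _ c ne = ⊥-elim (excluded (≢-sym α≢2) (≢-sym β≢2) 8 (PA₂.prefix 8) c)
      at 9 _ c ne = ⊥-elim (excluded (≢-sym α≢1) (≢-sym β≢1) 9 (PA₂.prefix 9) c)
      at p@(10+ _) h c ne = tail-connected p (+-monoʳ-≤ 10 z≤n) h c

    module Swap₃ = KempeChange A₂ α β α≢β Chain₃ Chain₃? (zigzag o i 10) start∈Chain₃ (λ w s → proj₁ s) Chain₃-closed
        Chain₃-connected

    A₃ : Map (suc m)
    A₃ = Swap₃.swapped

    Chain₃-proper : ProperChain A₂ α β (zigzag o i 10)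
    Chain₃-proper = Swap₃.proper-chain (zigzag o i 2) (inj₁ (PA₂.prefix 2)) (λ s → proj₂ s (inj₁ refl))

    wordA₃ : Pattern11
    wordA₃ = mkPattern11 c2 c1 α β c2 c1 α β c2 c1 β c2 α β

    swap₃-α : swap α β α ≡ β
    swap₃-α = swap-left α β
    swap₃-β′ : swap α β β ≡ α
    swap₃-β′ = swap-right α β α≢β

    outside-colours : ∀ p → p < period {m} → ∀ {x} → A₂ (zigzag o i p) ≡ x → x ≢ α → x ≢ β → A₃ (zigzag o i p) ≡ x
    outside-colours p h e a b' = trans (Swap₃.swapped-out (zigzag o i p)
        (λ s → ∉InC a b' (subst (InC α β) e (proj₁ s)))) e
    outside-kept : ∀ p → p < period {m} → Kept (zigzag o i p) → A₃ (zigzag o i p) ≡ A₂ (zigzag o i p)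
    outside-kept p h ee = Swap₃.swapped-out (zigzag o i p) (λ s → proj₂ s ee)

    A₃-follows : ∀ p → p < period {m} → A₃ (zigzag o i p) ≡ pattern11At wordA₃ p
    A₃-follows 0 h = outside-colours 0 h (A₂-follows 0 h) (≢-sym α≢2) (≢-sym β≢2)
    A₃-follows 1 h = outside-colours 1 h (A₂-follows 1 h) (≢-sym α≢1) (≢-sym β≢1)
    A₃-follows 2 h = trans (outside-kept 2 h (inj₁ refl)) (A₂-follows 2 h)
    A₃-follows 3 h = trans (outside-kept 3 h (inj₂ (inj₁ refl))) (A₂-follows 3 h)
    A₃-follows 4 h = outside-colours 4 h (A₂-follows 4 h) (≢-sym α≢2) (≢-sym β≢2)
    A₃-follows 5 h = outside-colours 5 h (A₂-follows 5 h) (≢-sym α≢1) (≢-sym β≢1)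
    A₃-follows 6 h = trans (outside-kept 6 h (inj₂ (inj₂ (inj₁ refl)))) (A₂-follows 6 h)
    A₃-follows 7 h = trans (outside-kept 7 h (inj₂ (inj₂ (inj₂ refl)))) (A₂-follows 7 h)
    A₃-follows 8 h = outside-colours 8 h (A₂-follows 8 h) (≢-sym α≢2) (≢-sym β≢2)
    A₃-follows 9 h = outside-colours 9 h (A₂-follows 9 h) (≢-sym α≢1) (≢-sym β≢1)
    A₃-follows 10 h = trans (Swap₃.swapped-in (zigzag o i 10) start∈Chain₃)
        (trans (cong (swap α β) (A₂-follows 10 h)) swap₃-α)
    A₃-follows (11+ k) h with residue3 k
    ... | 0mod3 q = trans (outside-colours _ h (PA₂.col-block q 0 h) (≢-sym α≢2) (≢-sym β≢2))
        (sym (cycle3-periodic c2 α β q 0))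
    ... | 1mod3 q = trans (Swap₃.swapped-in _ (inj₂ (PA₂.col-block q 1 h) , ∉Kept _ h (λ ()) (λ ()) (λ ()) (λ ())))
                          (trans (cong (swap α β) (PA₂.col-block q 1 h))
                              (trans swap₃-β′ (sym (cycle3-periodic c2 α β q 1))))
    ... | 2mod3 q = trans (Swap₃.swapped-in _ (inj₁ (PA₂.col-block q 2 h) , ∉Kept _ h (λ ()) (λ ()) (λ ()) (λ ())))
                          (trans (cong (swap α β) (PA₂.col-block q 2 h))
                              (trans swap₃-α (sym (cycle3-periodic c2 α β q 2))))

    module PA₃ = FollowsPattern11 o i A₃ wordA₃ R period≡ A₃-follows

    A₃-pole : A₃ pa ≡ c1
    A₃-pole = trans (Swap₃.swapped-out pa (λ s → ∉InC (≢-sym α≢1) (≢-sym β≢1) (subst (InC α β) A₂-pole (proj₁ s))))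
        A₂-pole

    Only₄ : V (suc m) → Set
    Only₄ w = InC c1 α (A₃ w) → w ≡ zigzag o i 9

    ∉pair₄ : ∀ {x} → x ≢ c1 → x ≢ α → ∀ {w} → A₃ w ≡ x → Only₄ w
    ∉pair₄ x≢1 x≢α e c = ⊥-elim (∉InC x≢1 x≢α (subst (InC c1 α) e c))

    9-isolated : ∀ u w → u ≡ zigzag o i 9 → Adj u w → InC c1 α (A₃ w) → w ≡ zigzag o i 9
    9-isolated _ w refl = neighbours-satisfy Only₄ 7 (⊥-elim ∘ odd-not-even 3)
                   (∉pair₄ β≢1 (≢-sym α≢β) (PA₃.prefix 7)) (∉pair₄ (λ ()) (≢-sym α≢2) (PA₃.prefix 8))
                   (∉pair₄ β≢1 (≢-sym α≢β) (PA₃.prefix 10)) (∉pair₄ (λ ()) (≢-sym α≢2) (PA₃.prefix 11)) w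

    module Swap₄ = KempeChange A₃ c1 α (≢-sym α≢1) (_≡ zigzag o i 9) (_≟ᵛ zigzag o i 9) (zigzag o i 9) refl
                     (λ w e → subst (λ z → InC c1 α (A₃ z)) (sym e) (inj₁ (PA₃.prefix 9))) 9-isolated
                     (λ w e → subst (Path A₃ c1 α (zigzag o i 9)) (sym e) here)

    B : Map (suc m)
    B = Swap₄.swapped

    Swap₄-proper : ProperChain A₃ c1 α (zigzag o i 9)
    Swap₄-proper = Swap₄.proper-chain pa (inj₁ A₃-pole) (λ e → zigzag≢pole o i 9 (sym e))

    B-pole : B pa ≡ c1
    B-pole = trans (Swap₄.swapped-out pa (λ e → zigzag≢pole o i 9 (sym e))) A₃-pole

    wordB : Pattern11
    wordB = mkPattern11 c2 c1 α β c2 c1 α β c2 α β c2 α β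

    B-follows : ∀ p → p < period {m} → B (zigzag o i p) ≡ pattern11At wordB p
    B-follows p h with p Data.Nat.≟ 9
    ... | yes refl = trans (Swap₄.swapped-in (zigzag o i 9) refl)
        (trans (cong (swap c1 α) (A₃-follows 9 h)) (swap-left c1 α))
    ... | no n = trans (Swap₄.swapped-out (zigzag o i p) (λ e → n (same-position 9 h e)))
        (trans (A₃-follows p h) (wordA₃≡wordB p n))
      where
      wordA₃≡wordB : ∀ p → p ≢ 9 → pattern11At wordA₃ p ≡ pattern11At wordB p
      wordA₃≡wordB 0 _ = refl
      wordA₃≡wordB 1 _ = refl
      wordA₃≡wordB 2 _ = refl
      wordA₃≡wordB 3 _ = refl
      wordA₃≡wordB 4 _ = refl
      wordA₃≡wordB 5 _ = refl
      wordA₃≡wordB 6 _ = refl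
      wordA₃≡wordB 7 _ = refl
      wordA₃≡wordB 8 _ = refl
      wordA₃≡wordB 9 n = ⊥-elim (n refl)
      wordA₃≡wordB 10 _ = refl
      wordA₃≡wordB (11+ k) _ = refl

    module PB = FollowsPattern11 o i B wordB R period≡ B-follows

    cycle3-shift₂ : ∀ k → cycle3 α β c2 (2 + k) ≡ cycle3 c2 α β k
    cycle3-shift₂ 0 = refl
    cycle3-shift₂ 1 = refl
    cycle3-shift₂ 2 = refl
    cycle3-shift₂ (suc (suc (suc k))) = cycle3-shift₂ k

    wordB-shifted : ∀ q → pattern11At wordB q ≡ patternAt (canonical α β) (2 + q)
    wordB-shifted 0 = refl
    wordB-shifted 1 = refl
    wordB-shifted 2 = refl
    wordB-shifted 3 = refl
    wordB-shifted 4 = refl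
    wordB-shifted 5 = refl
    wordB-shifted 6 = refl
    wordB-shifted 7 = refl
    wordB-shifted 8 = refl
    wordB-shifted 9 = refl
    wordB-shifted 10 = refl
    wordB-shifted (11+ k) = sym (cycle3-shift₂ k)

    move^-m : move^ o m i ≡ move (opposite o) i
    move^-m = trans (sym (move-opposite o (move^ o m i))) (cong (move (opposite o)) (move^-N o i))

    B-follows-canonical : ∀ p → p < period {m} → B (zigzag o (move (opposite o) i) p) ≡ patternAt (canonical α β) p
    B-follows-canonical 0 h = trans (cong B (trans (cong xa (sym move^-m)) (sym (zigzag-even o i m))))
        PB.col-second-last
    B-follows-canonical 1 h = trans (cong B (trans (cong (λ c → yb (yIndex o c)) (sym move^-m))
        (trans (sym (zigzag-odd o i m)) (cong (zigzag o i) (+-comm 1 (twice m)))))) PB.col-last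
    B-follows-canonical (suc (suc q)) h = trans (cong B (cong (λ j → zigzag o j q) (move-opposite⁻ o i)))
        (trans (B-follows q (<-trans (n<1+n q) (<-trans (n<1+n (suc q)) h))) (wordB-shifted q))

    module CB = CanonicalColouring o (move (opposite o) i) αβ R period≡ B B-pole B-follows-canonical

    result : Σ (Map (suc m)) λ B′ → NormColouring B′ × EquivUpTo 3 A B′ × Good B′ × ChainOf34 B′ (zigzagEdge o i 2)
    result = B , CB.normColouring ,
             via-A₂ (prop α β (zigzag o i 10) Swap₃.kempe Chain₃-proper
                 (prop c1 α (zigzag o i 9) Swap₄.kempe Swap₄-proper done)) ,
             CB.good , CB.chain (zigzagEdge o i 2) (trans (ends-edge₀ o (move o i))
                 (cong (λ j → zigzag o j 0 , zigzag o j 1) (sym (cong (move o) (move-opposite⁻ o i)))))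

module _ {m : ℕ} where

  edge-frame : ∀ (e : TE (suc m)) → Σ Dir λ o → Σ (Fin (suc m)) λ i → e ≡ zigzagEdge o i 4
  edge-frame (te1 j) = fw , prev (prev j) , cong te1 (sym (trans (cong next (next-prev (prev j))) (next-prev j)))
  edge-frame (te0 j) = bw , next (next j) , cong te0 (sym (trans (cong prev (prev-next (next j))) (prev-next j)))

  parallel-neighbours : ∀ o (i : Fin (suc m)) f → ConsecParallel (zigzagEdge o i 4) f →
                        f ≡ zigzagEdge o i 6 ⊎ f ≡ zigzagEdge o i 2
  parallel-neighbours fw i f (inj₁ refl) = inj₁ refl
  parallel-neighbours fw i (te1 c) (inj₂ e) = inj₂ (cong te1 (move-injective fw (sym (te1-injective e))))
  parallel-neighbours bw i f (inj₁ refl) = inj₂ (cong te0 (next-prev (prev i)))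
  parallel-neighbours bw i (te0 c) (inj₂ e) = inj₁ (cong te0
      (trans (sym (prev-next c)) (cong prev (sym (te0-injective e)))))

y-end : ∀ {n} (j : Fin n) e → Incident (yb j) e → yb j ≡ proj₂ (ends e)
y-end j (te0 _) (inj₁ ())
y-end j (te1 _) (inj₁ ())
y-end j (te0 _) (inj₂ e) = e
y-end j (te1 _) (inj₂ e) = e

module _ {m : ℕ} (3<m : 3 < m) (A : Map (suc m)) (normal : NormColouring A) (good : Good A)
         (o : Dir) (i : Fin (suc m)) (chain : ChainOf34 A (zigzagEdge o i 4)) where
  private
    module F = Forcing 3<m o i A normal good chain

  part-c-in-frame : ∀ e₂ → proj₂ (ends e₂) ≡ zigzag o i 5 →
                    Σ (Map (suc m)) λ B → NormColouring B × EqualCol A B × Good B × ChainOf34 B e₂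
  part-c-in-frame = ExchangeAlpha2.part-c o i F.colours34 F.R F.period≡ A (proj₂ normal) F.follows-canonical

  part-d-in-frame : ∀ f → f ≡ zigzagEdge o i 6 ⊎ f ≡ zigzagEdge o i 2 →
                    Σ (Map (suc m)) λ B → NormColouring B × EquivUpTo 3 A B × Good B × ChainOf34 B f
  part-d-in-frame _ (inj₁ refl) = M.Forward.result
    where module M = ParallelMoves o i F.colours34 F.R F.period≡ A (proj₂ normal) F.follows-canonical
  part-d-in-frame _ (inj₂ refl) = M.Backward.result
    where module M = ParallelMoves o i F.colours34 F.R F.period≡ A (proj₂ normal) F.follows-canonical

corollary2p1 : (n : ℕ) → 5 ≤ n → (A : Map n) → NormColouring A → Good A →
    ((e₁ e₂ : TE n) (j : Fin n) → Incident (yb j) e₁ → Incident (yb j) e₂ →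
       ChainOf34 A e₁ →
       Σ (Map n) λ B → NormColouring B × EqualCol A B × Good B × ChainOf34 B e₂)
    ×
    ((e f : TE n) → ConsecParallel e f → ChainOf34 A e →
       Σ (Map n) λ B → NormColouring B × EquivUpTo 3 A B × Good B × ChainOf34 B f)
corollary2p1 (suc m) (s≤s 3<m) A normal good = part-c , part-d
  where
  part-c : ∀ e₁ e₂ j → Incident (yb j) e₁ → Incident (yb j) e₂ → ChainOf34 A e₁ →
           Σ (Map (suc m)) λ B → NormColouring B × EqualCol A B × Good B × ChainOf34 B e₂
  part-c e₁ e₂ j y∈e₁ y∈e₂ chain with edge-frame e₁
  ... | o , i , refl = part-c-in-frame 3<m A normal good o i chain e₂
                         (trans (sym (y-end j e₂ y∈e₂)) (trans (y-end j (zigzagEdge o i 4) y∈e₁) (cong proj₂ (ends-edge₀ o _))))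
  part-d : ∀ e f → ConsecParallel e f → ChainOf34 A e →
           Σ (Map (suc m)) λ B → NormColouring B × EquivUpTo 3 A B × Good B × ChainOf34 B f
  part-d e f parallel chain with edge-frame e
  ... | o , i , refl = part-d-in-frame 3<m A normal good o i chain f (parallel-neighbours o i f parallel)
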